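{- Let $n\ge 1$ and $n+1\le i\le 2n$. The number of $x\in\mathsf{Pop}_{\mathrm{Weak}(B_n)}(\mathrm{Weak}(B_n))$ with $x_1=i$ and $|\mathscr{U}_{\mathrm{Weak}(B_n)}(x)|=n-1$ is $2^{2n-i}-1$.
   Context: $B_n$ is the set of permutations $x=x_1\cdots x_{2n}$ of $\{1,\dots,2n\}$ with $x_i+x_{2n+1-i}=2n+1$ for all $i$; $\mathrm{Weak}(B_n)$ is $B_n$ with the right weak order ($x\le y$ iff every pair of values $a<b$ with $b$ before $a$ in $x$ also has $b$ before $a$ in $y$). For a finite lattice $M$, $\mathsf{Pop}_M(x)$ is the meet of $x$ and all elements it covers (in $\mathrm{Weak}(B_n)$: reverse each maximal descending run of $x$), $\mathsf{Pop}_M(M)$ is its image, and $\mathscr{U}_M(x)$ is the set of elements covering $x$; in $\mathrm{Weak}(B_n)$, $|\mathscr{U}(x)|=\#\{i\in\{1,\dots,n\}:x_i<x_{i+1}\}$. -}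

module Defs where

open import Data.Nat using (ℕ; zero; suc; _+_; _*_; _∸_; _≤_; _<ᵇ_)
open import Data.Bool using (if_then_else_)
open import Data.Fin using (Fin; opposite)
open import Data.List using (List; []; _∷_; _++_; length; take; lookup)
open import Data.Product using (_×_; Σ)
open import Relation.Binary.PropositionalEquality using (_≡_)
open import Function.Definitions using (Injective)

-- A word x = x₁⋯x_{2n} is represented as a list of naturals (x₁ first).
-- Membership in B_n: length 2n, entries in {1,…,2n}, pairwise distinct
-- (hence a permutation of {1,…,2n}), and x_i + x_{2n+1-i} = 2n+1
-- (position k (0-based) is paired with position 2n-1-k, i.e. `opposite`).
record IsBn (n : ℕ) (x : List ℕ) : Set where
  field
    len      : length x ≡ 2 * n
    range    : ∀ (k : Fin (length x)) → 1 ≤ lookup x k × lookup x k ≤ 2 * n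
    distinct : Injective _≡_ _≡_ (lookup x)
    symm     : ∀ (k : Fin (length x)) → lookup x k + lookup x (opposite k) ≡ suc (2 * n)

-- Pop in Weak(B_n): reverse each maximal descending run of x.
-- popAux acc xs : acc is the current (descending) run stored reversed
-- (its head is the last letter read); xs is the remaining input.
popAux : List ℕ → List ℕ → List ℕ
popAux acc [] = acc
popAux [] (b ∷ xs) = popAux (b ∷ []) xs
popAux (a ∷ acc) (b ∷ xs) =
  if b <ᵇ a then popAux (b ∷ a ∷ acc) xs
            else (a ∷ acc) ++ popAux (b ∷ []) xs

pop : List ℕ → List ℕ
pop = popAux []

InPopImage : ℕ → List ℕ → Set
InPopImage n x = IsBn n x × Σ (List ℕ) (λ y → IsBn n y × pop y ≡ x)

ascents : List ℕ → ℕ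
ascents (a ∷ b ∷ xs) = (if a <ᵇ b then 1 else 0) + ascents (b ∷ xs)
ascents _ = 0

-- |U(x)| in Weak(B_n) = #{ i ∈ {1,…,n} : x_i < x_{i+1} }  (uses x₁ … x_{n+1})
upperCovers : ℕ → List ℕ → ℕ
upperCovers n x = ascents (take (suc n) x)

-- An x ∈ B_n is determined by its first half h, the second half being the
-- reversal of h with every letter z replaced by z̄ = 2n + 1 − z. If x₁ = i > n
-- and x₁⋯x_{n+1} has a single descent, then h = A B with A an increasing run
-- of letters > n starting at i and B an increasing run of letters ≤ n.
-- For a preimage y of x under Pop, the descent between A and B separates two
-- runs of y; comparing them shows that the increasing run of x from the first
-- letter q of B, which ends at q̄, reaches a letter of A. So q̄ ≥ i, and q̄ ≠ i
-- because x ∈ B_n; hence q < m := 2n + 1 − i. Conversely, reversing A and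
-- complementing B gives a preimage. Thus x corresponds to the set
-- {z̄ : z ∈ A} ⊆ {1, …, m}, which contains m and omits some q < m: there are
-- 2^(m−1) − 1 = 2^(2n−i) − 1 of them.

module Submission where

open import Defs
open import Data.Bool using (Bool; true; false; T; if_then_else_)
open import Data.Bool.Properties using (⇔→≡)
open import Data.Empty using (⊥; ⊥-elim)
open import Data.Fin using (Fin; toℕ; fromℕ<; opposite)
open import Data.Fin.Properties using (toℕ-fromℕ<; opposite-prop; toℕ<n)
open import Data.List using (List; []; _∷_; _++_; [_]; length; take; drop; lookup; map; reverse; head; initLast; _∷ʳ′_)
open import Data.List.Properties
open import Data.List.Membership.Propositional using (_∈_; _∉_)
open import Data.List.Membership.Propositional.Properties using (∈-lookup; ∈-map⁺; ∈-map⁻; ∈-++⁺ˡ; ∈-++⁺ʳ; ∈-++⁻)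
open import Data.List.Relation.Binary.Subset.Propositional using (_⊆_)
open import Data.List.Relation.Unary.All as All using (All; []; _∷_)
import Data.List.Relation.Unary.All.Properties as All
open import Data.List.Relation.Unary.AllPairs as AllPairs using (AllPairs; []; _∷_)
import Data.List.Relation.Unary.AllPairs.Properties as AllPairs
open import Data.List.Relation.Unary.Any as Any using (here; there)
import Data.List.Relation.Unary.Any.Properties as Any
open import Data.List.Relation.Unary.Linked using (Linked; []; [-]; _∷_)
open import Data.List.Relation.Unary.Linked.Properties using (AllPairs⇒Linked; Linked⇒AllPairs)
open import Data.List.Relation.Unary.Unique.Propositional using (Unique)
import Data.List.Relation.Unary.Unique.Propositional.Properties as Unique
open import Data.List.Reverse using (Reverse; []; _∶_∶ʳ_; reverseView)
open import Data.Maybe using (just)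
open import Data.Maybe.Relation.Binary.Connected using (Connected; just; just-nothing)
open import Data.Nat using (ℕ; zero; suc; _+_; _*_; _∸_; _^_; _≤_; _<_; z≤n; s≤s; s≤s⁻¹; _<ᵇ_; >-nonZero)
open import Data.Nat.Properties
open import Data.List.Membership.DecPropositional _≟_ using (_∈?_)
open import Data.Product using (_×_; _,_; proj₁; proj₂; Σ; ∃-syntax)
open import Data.Sum using (_⊎_; inj₁; inj₂)
open import Data.Unit using (tt)
open import Data.Vec using (Vec; []; _∷_; _∷ʳ_; tabulate)
import Data.Vec.Properties as Vec
open import Function.Base using (case_of_)
open import Function.Bundles using (_⇔_; mk⇔)
open import Function.Definitions using (Injective)
import Function.Properties.Equivalence as ⇔
open import Relation.Binary.Definitions using (tri<; tri≈; tri>)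
open import Relation.Binary.PropositionalEquality hiding ([_])
open import Relation.Nullary using (yes; no; contradiction)
open import Relation.Nullary.Decidable using (does; dec-true; dec-false)

<⇒<ᵇ≡true : ∀ {m n} → m < n → (m <ᵇ n) ≡ true
<⇒<ᵇ≡true {m} {n} = dec-true (m <? n)

≤⇒<ᵇ≡false : ∀ {m n} → n ≤ m → (m <ᵇ n) ≡ false
≤⇒<ᵇ≡false {m} {n} n≤m = dec-false (m <? n) (≤⇒≯ n≤m)

<ᵇ≡true⇒< : ∀ {m n} → (m <ᵇ n) ≡ true → m < n
<ᵇ≡true⇒< {m} {n} eq = <ᵇ⇒< m n (subst T (sym eq) tt)

<ᵇ≡false⇒≥ : ∀ {m n} → (m <ᵇ n) ≡ false → n ≤ m
<ᵇ≡false⇒≥ eq = ≮⇒≥ λ m<n → subst T eq (<⇒<ᵇ m<n)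

reflect-< : ∀ {N j} → j < N → N ∸ suc j < N
reflect-< {suc N} {j} _ = s≤s (m∸n≤m N j)

reflect-involutive : ∀ {N j} → j < N → N ∸ suc (N ∸ suc j) ≡ j
reflect-involutive {suc N} (s≤s j≤N) = m∸[m∸n]≡n j≤N

2*n≡n+n : ∀ n → 2 * n ≡ n + n
2*n≡n+n n = cong (n +_) (+-identityʳ n)

reflect-upperHalf : ∀ {n j} → n ≤ j → j < 2 * n → 2 * n ∸ suc j < n
reflect-upperHalf {suc n} {j} n<j _ = begin-strict
  2 * suc n ∸ suc j           ≤⟨ ∸-monoʳ-≤ (2 * suc n) (s≤s n<j) ⟩
  suc n + (suc n + 0) ∸ suc (suc n) ≡⟨ cong (λ m → n + m ∸ suc n) (+-identityʳ (suc n)) ⟩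
  n + suc n ∸ suc n           ≡⟨ m+n∸n≡m n (suc n) ⟩
  n                           <⟨ n<1+n n ⟩
  suc n                       ∎
  where open ≤-Reasoning

n≤2n+1 : ∀ n → n ≤ suc (2 * n)
n≤2n+1 n = ≤-trans (m≤m+n n _) (n≤1+n _)

-- Positional access with a junk value 0 past the end, so that index
-- arithmetic can be done in ℕ rather than in Fin.
nth : List ℕ → ℕ → ℕ
nth []       _       = 0
nth (x ∷ xs) zero    = x
nth (x ∷ xs) (suc j) = nth xs j

lookup≡nth : ∀ xs (k : Fin (length xs)) → lookup xs k ≡ nth xs (toℕ k)
lookup≡nth (x ∷ xs) Fin.zero    = refl
lookup≡nth (x ∷ xs) (Fin.suc k) = lookup≡nth xs k

nth-∈ : ∀ xs {j} → j < length xs → nth xs j ∈ xs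
nth-∈ (x ∷ xs) {zero}  _         = here refl
nth-∈ (x ∷ xs) {suc j} (s≤s j<) = there (nth-∈ xs j<)

nth-++ˡ : ∀ xs ys {j} → j < length xs → nth (xs ++ ys) j ≡ nth xs j
nth-++ˡ (x ∷ xs) ys {zero}  _         = refl
nth-++ˡ (x ∷ xs) ys {suc j} (s≤s j<) = nth-++ˡ xs ys j<

nth-++ʳ : ∀ xs ys j → nth (xs ++ ys) (length xs + j) ≡ nth ys j
nth-++ʳ []       ys j = refl
nth-++ʳ (x ∷ xs) ys j = nth-++ʳ xs ys j

nth-map : ∀ f xs {j} → j < length xs → nth (map f xs) j ≡ f (nth xs j)
nth-map f (x ∷ xs) {zero}  _         = refl
nth-map f (x ∷ xs) {suc j} (s≤s j<) = nth-map f xs j<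

nth-reverse : ∀ xs {j} → j < length xs → nth (reverse xs) j ≡ nth xs (length xs ∸ suc j)
nth-reverse (x ∷ xs) {j} j≤ rewrite unfold-reverse x xs with j <? length xs
... | yes j< = begin
  nth (reverse xs ++ [ x ]) j     ≡⟨ nth-++ˡ (reverse xs) [ x ] (subst (j <_) (sym (length-reverse xs)) j<) ⟩
  nth (reverse xs) j              ≡⟨ nth-reverse xs j< ⟩
  nth xs (length xs ∸ suc j)      ≡⟨ cong (nth (x ∷ xs)) (sym (+-∸-assoc 1 j<)) ⟩
  nth (x ∷ xs) (length xs ∸ j)    ∎
  where open ≡-Reasoning
... | no j≮ with refl ← ≤-antisym (s≤s⁻¹ j≤) (≮⇒≥ j≮) rewrite n∸n≡0 (length xs) = begin
  nth (reverse xs ++ [ x ]) (length xs)             ≡⟨ cong (λ l → nth (reverse xs ++ [ x ]) l) (sym (length-reverse xs)) ⟩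
  nth (reverse xs ++ [ x ]) (length (reverse xs))   ≡⟨ cong (nth (reverse xs ++ [ x ])) (sym (+-identityʳ _)) ⟩
  nth (reverse xs ++ [ x ]) (length (reverse xs) + 0) ≡⟨ nth-++ʳ (reverse xs) [ x ] 0 ⟩
  x                                                 ∎
  where open ≡-Reasoning

nth-ext : ∀ xs ys → length xs ≡ length ys → (∀ {j} → j < length xs → nth xs j ≡ nth ys j) → xs ≡ ys
nth-ext []       []       _  _  = refl
nth-ext (x ∷ xs) (y ∷ ys) eq pt =
  cong₂ _∷_ (pt (s≤s z≤n)) (nth-ext xs ys (suc-injective eq) (λ j< → pt (s≤s j<)))

Unique⇒lookup-injective : ∀ (xs : List ℕ) → Unique xs → Injective _≡_ _≡_ (lookup xs)
Unique⇒lookup-injective (x ∷ xs) (x∉ ∷ u) {Fin.zero}  {Fin.zero}  _  = refl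
Unique⇒lookup-injective (x ∷ xs) (x∉ ∷ u) {Fin.zero}  {Fin.suc k} eq = ⊥-elim (All.lookup x∉ (∈-lookup k) eq)
Unique⇒lookup-injective (x ∷ xs) (x∉ ∷ u) {Fin.suc k} {Fin.zero}  eq = ⊥-elim (All.lookup x∉ (∈-lookup k) (sym eq))
Unique⇒lookup-injective (x ∷ xs) (x∉ ∷ u) {Fin.suc k} {Fin.suc l} eq = cong Fin.suc (Unique⇒lookup-injective xs u eq)

lookup-injective⇒Unique : ∀ (xs : List ℕ) → Injective _≡_ _≡_ (lookup xs) → Unique xs
lookup-injective⇒Unique []       _   = []
lookup-injective⇒Unique (x ∷ xs) inj =
  All.tabulate x∉xs ∷ lookup-injective⇒Unique xs (λ eq → Data.Fin.Properties.suc-injective (inj eq))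
  where
  x∉xs : ∀ {z} → z ∈ xs → x ≢ z
  x∉xs z∈ eq with () ← inj {Fin.zero} {Fin.suc (Any.index z∈)} (trans eq (Any.lookup-index z∈))

All-reverse : ∀ {P : ℕ → Set} {xs} → All P xs → All P (reverse xs)
All-reverse ps = All.tabulate (λ z∈ → All.lookup ps (Any.reverse⁻ z∈))

Unique-reverse : ∀ (xs : List ℕ) → Unique xs → Unique (reverse xs)
Unique-reverse []       _          = []
Unique-reverse (x ∷ xs) (x∉ ∷ u) rewrite unfold-reverse x xs =
  Unique.++⁺ (Unique-reverse xs u) ([] ∷ []) λ where
    (z∈ , here refl) → All.lookup x∉ (Any.reverse⁻ z∈) refl

take-length-++ : ∀ (xs ys : List ℕ) j → take (length xs + j) (xs ++ ys) ≡ xs ++ take j ys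
take-length-++ []       ys j = refl
take-length-++ (x ∷ xs) ys j = cong (x ∷_) (take-length-++ xs ys j)

split-snoc : ∀ (h : List ℕ) e u v → h ++ [ e ] ≡ u ++ v → v ≢ [] → ∃[ B ] (v ≡ B ++ [ e ] × h ≡ u ++ B)
split-snoc h        e []      v eq    _   = h , sym eq , refl
split-snoc []       e (x ∷ []) [] eq v≢[] = ⊥-elim (v≢[] refl)
split-snoc []       e (x ∷ []) (_ ∷ _) ()
split-snoc []       e (x ∷ _ ∷ _) v ()
split-snoc (x′ ∷ h) e (x ∷ u) v eq v≢[]
  with refl , eq′ ← ∷-injective eq
  with B , v≡ , h≡ ← split-snoc h e u v eq′ v≢[] = B , v≡ , cong (x ∷_) h≡

head-++⁻ : ∀ (l r : List ℕ) → 0 < length l → head (l ++ r) ≡ head l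
head-++⁻ (_ ∷ _) r _ = refl

head-snoc : ∀ {q e : ℕ} {post} B → q ∷ post ≡ B ++ [ e ] → B ≢ [] → head B ≡ just q
head-snoc []      _  B≢[] = ⊥-elim (B≢[] refl)
head-snoc (b ∷ B) eq _    = cong just (sym (proj₁ (∷-injective eq)))

head⇒∷ : ∀ {l : List ℕ} {a} → head l ≡ just a → ∃[ l′ ] (l ≡ a ∷ l′)
head⇒∷ {a ∷ l} refl = l , refl

head⇒∈ : ∀ {l : List ℕ} {a} → head l ≡ just a → a ∈ l
head⇒∈ {a ∷ l} refl = here refl

Linked-middle : ∀ {R : ℕ → ℕ → Set} l {x y t} → Linked R (l ++ x ∷ y ∷ t) → R x y
Linked-middle []          (Rxy ∷ _) = Rxy
Linked-middle (_ ∷ [])    (_ ∷ ls)  = Linked-middle [] ls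
Linked-middle (_ ∷ z ∷ l) (_ ∷ ls)  = Linked-middle (z ∷ l) ls

Increasing : List ℕ → Set
Increasing = AllPairs _<_

Increasing⇒Unique : ∀ {l} → Increasing l → Unique l
Increasing⇒Unique = AllPairs.map <⇒≢

Increasing-∷⇒head≤ : ∀ {a l z} → Increasing (a ∷ l) → z ∈ a ∷ l → a ≤ z
Increasing-∷⇒head≤ _            (here refl) = ≤-refl
Increasing-∷⇒head≤ (a< ∷ _) (there z∈)  = <⇒≤ (All.lookup a< z∈)

Increasing⇒head≤ : ∀ {l a z} → head l ≡ just a → Increasing l → z ∈ l → a ≤ z
Increasing⇒head≤ {a ∷ l} refl = Increasing-∷⇒head≤

Increasing⇒∃head≤ : ∀ {l z} → Increasing l → z ∈ l → ∃[ b ] (head l ≡ just b × b ≤ z)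
Increasing⇒∃head≤ {b ∷ l} inc z∈ = b , refl , Increasing-∷⇒head≤ inc z∈

Increasing⇒<last : ∀ l {e z} → Increasing (l ++ [ e ]) → z ∈ l → z < e
Increasing⇒<last (a ∷ l) (a< ∷ _)   (here refl) = All.lookup a< (∈-++⁺ʳ l (here refl))
Increasing⇒<last (a ∷ l) (_ ∷ inc) (there z∈)  = Increasing⇒<last l inc z∈

Increasing-init : ∀ l {e} → Increasing (l ++ [ e ]) → Increasing l
Increasing-init []      _            = []
Increasing-init (x ∷ l) (x< ∷ inc) = All.++⁻ˡ l x< ∷ Increasing-init l inc

⊆-∷⁻ : ∀ {l y ys} → All (y <_) l → l ⊆ y ∷ ys → l ⊆ ys
⊆-∷⁻ y< l⊆ z∈ = Any.tail (λ z≡y → <-irrefl (sym z≡y) (All.lookup y< z∈)) (l⊆ z∈)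

module _ {x xs y ys} (incˣ : Increasing (x ∷ xs)) (incʸ : Increasing (y ∷ ys)) (⊆ʸ : x ∷ xs ⊆ y ∷ ys) where

  ⊆-tails : x ≡ y → xs ⊆ ys
  ⊆-tails refl = ⊆-∷⁻ (AllPairs.head incˣ) (λ z∈ → ⊆ʸ (there z∈))

  ⊆-tail : x ≢ y → x ∷ xs ⊆ ys
  ⊆-tail x≢y = ⊆-∷⁻ (y<x ∷ All.map (<-trans y<x) (AllPairs.head incˣ)) ⊆ʸ
    where
    y<x : y < x
    y<x = ≤∧≢⇒< (Increasing-∷⇒head≤ incʸ (⊆ʸ (here refl))) (λ y≡x → x≢y (sym y≡x))

Increasing-⊆⇒length≤ : ∀ {xs ys} → Increasing xs → Increasing ys → xs ⊆ ys → length xs ≤ length ys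
Increasing-⊆⇒length≤ {[]}                  _     _     _   = z≤n
Increasing-⊆⇒length≤ {x ∷ xs} {[]}         _     _     ⊆ʸ with () ← ⊆ʸ (here refl)
Increasing-⊆⇒length≤ {x ∷ xs} {y ∷ ys}     incˣ incʸ ⊆ʸ with x ≟ y
... | yes x≡y = s≤s (Increasing-⊆⇒length≤ (AllPairs.tail incˣ) (AllPairs.tail incʸ) (⊆-tails incˣ incʸ ⊆ʸ x≡y))
... | no  x≢y = m≤n⇒m≤1+n (Increasing-⊆⇒length≤ incˣ (AllPairs.tail incʸ) (⊆-tail incˣ incʸ ⊆ʸ x≢y))

Increasing-⊆⇒≡ : ∀ {xs ys} → Increasing xs → Increasing ys → xs ⊆ ys → length ys ≤ length xs → xs ≡ ys
Increasing-⊆⇒≡ {[]}                  {[]}  _ _ _ _ = refl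
Increasing-⊆⇒≡ {x ∷ xs} {[]}         _     _     ⊆ʸ _ with () ← ⊆ʸ (here refl)
Increasing-⊆⇒≡ {x ∷ xs} {y ∷ ys}     incˣ incʸ ⊆ʸ ≤ˣ with x ≟ y
... | yes refl = cong (x ∷_) (Increasing-⊆⇒≡ (AllPairs.tail incˣ) (AllPairs.tail incʸ) (⊆-tails incˣ incʸ ⊆ʸ refl) (s≤s⁻¹ ≤ˣ))
... | no  x≢y = contradiction (≤-trans (s≤s (Increasing-⊆⇒length≤ incˣ (AllPairs.tail incʸ) (⊆-tail incˣ incʸ ⊆ʸ x≢y))) ≤ˣ) (<-irrefl refl)

-- Complements and mirror words

InRange : ℕ → ℕ → Set
InRange n z = 1 ≤ z × z ≤ 2 * n

bar : ℕ → ℕ → ℕ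
bar n z = suc (2 * n) ∸ z

barRev : ℕ → List ℕ → List ℕ
barRev n h = map (bar n) (reverse h)

mirror : ℕ → List ℕ → List ℕ
mirror n h = h ++ barRev n h

InRange⇒≤2n+1 : ∀ n {z} → InRange n z → z ≤ suc (2 * n)
InRange⇒≤2n+1 n (_ , z≤2n) = m≤n⇒m≤1+n z≤2n

bar-involutive : ∀ n {z} → z ≤ suc (2 * n) → bar n (bar n z) ≡ z
bar-involutive n = m∸[m∸n]≡n

bar-InRange : ∀ n {z} → InRange n z → InRange n (bar n z)
bar-InRange n {suc z} (_ , z<2n) = m<n⇒0<n∸m (s≤s z<2n) , m∸n≤m (2 * n) z

bar-injective : ∀ n {a b} → a ≤ suc (2 * n) → b ≤ suc (2 * n) → bar n a ≡ bar n b → a ≡ b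
bar-injective n = ∸-cancelˡ-≡

bar-suc : ∀ n → bar n (suc n) ≡ n
bar-suc n = trans (cong (_∸ n) (2*n≡n+n n)) (m+n∸m≡n n n)

bar-self : ∀ n → bar n n ≡ suc n
bar-self n = trans (+-∸-assoc 1 (m≤m+n n _)) (cong suc (trans (cong (_∸ n) (2*n≡n+n n)) (m+n∸m≡n n n)))

≤⇒<bar : ∀ n {v} → v ≤ n → n < bar n v
≤⇒<bar n v≤n = ≤-trans (≤-reflexive (sym (bar-self n))) (∸-monoʳ-≤ (suc (2 * n)) v≤n)

<⇒bar≤ : ∀ n {v} → n < v → bar n v ≤ n
<⇒bar≤ n {v} n<v = subst (bar n v ≤_) (bar-suc n) (∸-monoʳ-≤ (suc (2 * n)) n<v)

map-bar-involutive : ∀ n {l} → All (_≤ suc (2 * n)) l → map (bar n) (map (bar n) l) ≡ l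
map-bar-involutive n []         = refl
map-bar-involutive n (z≤ ∷ l≤) = cong₂ _∷_ (bar-involutive n z≤) (map-bar-involutive n l≤)

reverse-barRev : ∀ n l → reverse (barRev n l) ≡ map (bar n) l
reverse-barRev n l = trans (sym (reverse-map (bar n) (reverse l))) (cong (map (bar n)) (reverse-involutive l))

reverse-mirror : ∀ n l → reverse (l ++ barRev n l) ≡ map (bar n) l ++ reverse l
reverse-mirror n l = trans (reverse-++ l (barRev n l)) (cong (_++ reverse l) (reverse-barRev n l))

length-barRev : ∀ n l → length (barRev n l) ≡ length l
length-barRev n l = trans (length-map (bar n) (reverse l)) (length-reverse l)

Unique-map-bar : ∀ n {l} → All (InRange n) l → Unique l → Unique (map (bar n) l)
Unique-map-bar n []          []         = []
Unique-map-bar n (zr ∷ rs) (z∉ ∷ u) = distinct zr rs z∉ ∷ Unique-map-bar n rs u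
  where
  distinct : ∀ {z ys} → InRange n z → All (InRange n) ys → All (z ≢_) ys → All (bar n z ≢_) (map (bar n) ys)
  distinct zr []          []          = []
  distinct zr (yr ∷ yrs) (z≢y ∷ ps) =
    (λ eq → z≢y (bar-injective n (InRange⇒≤2n+1 n zr) (InRange⇒≤2n+1 n yr) eq)) ∷ distinct zr yrs ps

length-mirror : ∀ n h → length h ≡ n → length (mirror n h) ≡ 2 * n
length-mirror n h refl = begin
  length (h ++ barRev n h)           ≡⟨ length-++ h ⟩
  length h + length (barRev n h)     ≡⟨ cong (length h +_) (length-barRev n h) ⟩
  length h + length h                ≡⟨ sym (2*n≡n+n (length h)) ⟩
  2 * length h                       ∎
  where open ≡-Reasoning

mirror-sym-firstHalf : ∀ n h → length h ≡ n → All (InRange n) h → ∀ {j} → j < n →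
  nth (mirror n h) j + nth (mirror n h) (2 * n ∸ suc j) ≡ suc (2 * n)
mirror-sym-firstHalf n h refl hr {j} j<n = begin
  nth x j + nth x (2 * n ∸ suc j)
    ≡⟨ cong₂ _+_ (nth-++ˡ h _ j<n) (cong (nth x) (trans (cong (_∸ suc j) (2*n≡n+n n)) (+-∸-assoc n j<n))) ⟩
  nth h j + nth x (n + j′)                 ≡⟨ cong (nth h j +_) (nth-++ʳ h _ j′) ⟩
  nth h j + nth (barRev n h) j′            ≡⟨ cong (nth h j +_) (nth-map (bar n) (reverse h) j′<) ⟩
  nth h j + bar n (nth (reverse h) j′)
    ≡⟨ cong (λ v → nth h j + bar n v) (trans (nth-reverse h (reflect-< j<n)) (cong (nth h) (reflect-involutive j<n))) ⟩
  nth h j + bar n (nth h j)                ≡⟨ m+[n∸m]≡n (InRange⇒≤2n+1 n (All.lookup hr (nth-∈ h j<n))) ⟩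
  suc (2 * n)                              ∎
  where
  open ≡-Reasoning
  x = mirror n h
  j′ = n ∸ suc j
  j′< : j′ < length (reverse h)
  j′< = subst (j′ <_) (sym (length-reverse h)) (reflect-< j<n)

mirror-sym : ∀ n h → length h ≡ n → All (InRange n) h → ∀ {j} → j < 2 * n →
  nth (mirror n h) j + nth (mirror n h) (2 * n ∸ suc j) ≡ suc (2 * n)
mirror-sym n h lh hr {j} j<2n with j <? n
... | yes j<n = mirror-sym-firstHalf n h lh hr j<n
... | no j≮n = begin
  nth x j + nth x j′                       ≡⟨ +-comm (nth x j) _ ⟩
  nth x j′ + nth x j                       ≡⟨ cong (λ i → nth x j′ + nth x i) (sym (reflect-involutive j<2n)) ⟩
  nth x j′ + nth x (2 * n ∸ suc j′)        ≡⟨ mirror-sym-firstHalf n h lh hr j′<n ⟩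
  suc (2 * n)                              ∎
  where
  open ≡-Reasoning
  x = mirror n h
  j′ = 2 * n ∸ suc j
  j′<n : j′ < n
  j′<n = reflect-upperHalf (≮⇒≥ j≮n) j<2n

isBn-mirror : ∀ n h → length h ≡ n → All (InRange n) h → Unique h → (∀ {z} → z ∈ h → bar n z ∉ h) →
  IsBn n (mirror n h)
isBn-mirror n h lh hr uh noBar = record
  { len      = lx
  ; range    = λ k → All.lookup xr (∈-lookup k)
  ; distinct = Unique⇒lookup-injective x ux
  ; symm     = λ k → begin
      lookup x k + lookup x (opposite k)
        ≡⟨ cong₂ _+_ (lookup≡nth x k) (trans (lookup≡nth x (opposite k)) (cong (nth x) (trans (opposite-prop k) (cong (_∸ suc (toℕ k)) lx)))) ⟩
      nth x (toℕ k) + nth x (2 * n ∸ suc (toℕ k))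
        ≡⟨ mirror-sym n h lh hr (subst (toℕ k <_) lx (toℕ<n k)) ⟩
      suc (2 * n) ∎
  }
  where
  open ≡-Reasoning
  x = mirror n h
  lx = length-mirror n h lh
  xr : All (InRange n) x
  xr = All.++⁺ hr (All.map⁺ (All-reverse (All.map (bar-InRange n) hr)))
  disjoint : ∀ {v} → v ∈ h × v ∈ barRev n h → ⊥
  disjoint (v∈h , v∈bar) with w , w∈ , refl ← ∈-map⁻ (bar n) v∈bar =
    noBar v∈h (subst (_∈ h) (sym (bar-involutive n (InRange⇒≤2n+1 n (All.lookup hr w∈h)))) w∈h)
    where w∈h = Any.reverse⁻ w∈
  ux : Unique x
  ux = Unique.++⁺ uh (Unique-map-bar n (All-reverse hr) (Unique-reverse h uh)) disjoint

take-mirror : ∀ n h → length h ≡ n → take n (mirror n h) ≡ h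
take-mirror n h refl = trans (cong (λ m → take m (mirror n h)) (sym (+-identityʳ (length h))))
                             (trans (take-length-++ h (barRev n h) 0) (++-identityʳ h))

mirror-runs : ∀ n A B → mirror n (A ++ B) ≡ A ++ (B ++ barRev n B) ++ barRev n A
mirror-runs n A B = begin
  (A ++ B) ++ map (bar n) (reverse (A ++ B))           ≡⟨ cong (λ l → (A ++ B) ++ map (bar n) l) (reverse-++ A B) ⟩
  (A ++ B) ++ map (bar n) (reverse B ++ reverse A)     ≡⟨ cong ((A ++ B) ++_) (map-++ (bar n) (reverse B) (reverse A)) ⟩
  (A ++ B) ++ barRev n B ++ barRev n A                 ≡⟨ ++-assoc A B _ ⟩
  A ++ B ++ barRev n B ++ barRev n A                   ≡⟨ cong (A ++_) (sym (++-assoc B (barRev n B) _)) ⟩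
  A ++ (B ++ barRev n B) ++ barRev n A                 ∎
  where open ≡-Reasoning

mirror-swapped-runs : ∀ n A {B} → All (_≤ suc (2 * n)) B →
  mirror n (reverse A ++ map (bar n) B) ≡ reverse A ++ reverse (B ++ barRev n B) ++ reverse (barRev n A)
mirror-swapped-runs n A {B} B≤ = begin
  (reverse A ++ map (bar n) B) ++ barRev n (reverse A ++ map (bar n) B)
    ≡⟨ cong (λ l → (reverse A ++ map (bar n) B) ++ map (bar n) l)
            (trans (reverse-++ (reverse A) (map (bar n) B)) (cong₂ _++_ (sym (reverse-map (bar n) B)) (reverse-involutive A))) ⟩
  (reverse A ++ map (bar n) B) ++ map (bar n) (barRev n B ++ A)
    ≡⟨ cong ((reverse A ++ map (bar n) B) ++_)
            (trans (map-++ (bar n) (barRev n B) A) (cong (_++ map (bar n) A) (map-bar-involutive n (All-reverse B≤)))) ⟩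
  (reverse A ++ map (bar n) B) ++ reverse B ++ map (bar n) A
    ≡⟨ ++-assoc (reverse A) (map (bar n) B) _ ⟩
  reverse A ++ map (bar n) B ++ reverse B ++ map (bar n) A
    ≡⟨ cong (reverse A ++_) (sym (++-assoc (map (bar n) B) (reverse B) _)) ⟩
  reverse A ++ (map (bar n) B ++ reverse B) ++ map (bar n) A
    ≡⟨ cong₂ (λ l l′ → reverse A ++ l ++ l′) (sym (reverse-mirror n B)) (sym (reverse-barRev n A)) ⟩
  reverse A ++ reverse (B ++ barRev n B) ++ reverse (barRev n A) ∎
  where open ≡-Reasoning

module _ {n x} (bx : IsBn n x) where

  isBn⇒Unique : Unique x
  isBn⇒Unique = lookup-injective⇒Unique x (IsBn.distinct bx)

  isBn⇒InRange : All (InRange n) x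
  isBn⇒InRange = All.tabulate λ z∈ → subst (InRange n) (sym (Any.lookup-index z∈)) (IsBn.range bx (Any.index z∈))

  private
    length≡n+n : length x ≡ n + n
    length≡n+n = trans (IsBn.len bx) (2*n≡n+n n)

  length-take-isBn : length (take n x) ≡ n
  length-take-isBn = trans (length-take n x) (m≤n⇒m⊓n≡m (subst (n ≤_) (sym length≡n+n) (m≤m+n n n)))

  isBn-sym : ∀ {j} → j < n → nth x (n + j) + nth x (n ∸ suc j) ≡ suc (2 * n)
  isBn-sym {j} j<n = begin
    nth x (n + j) + nth x (n ∸ suc j)        ≡⟨ cong₂ (λ a b → nth x a + nth x b) (sym (toℕ-fromℕ< _)) (sym opposite-k) ⟩
    nth x (toℕ k) + nth x (toℕ (opposite k)) ≡⟨ sym (cong₂ _+_ (lookup≡nth x k) (lookup≡nth x (opposite k))) ⟩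
    lookup x k + lookup x (opposite k)       ≡⟨ IsBn.symm bx k ⟩
    suc (2 * n)                              ∎
    where
    open ≡-Reasoning
    k : Fin (length x)
    k = fromℕ< (subst (n + j <_) (sym length≡n+n) (+-monoʳ-< n j<n))
    opposite-k : toℕ (opposite k) ≡ n ∸ suc j
    opposite-k = begin
      toℕ (opposite k)          ≡⟨ opposite-prop k ⟩
      length x ∸ suc (toℕ k)    ≡⟨ cong₂ (λ a b → a ∸ suc b) length≡n+n (toℕ-fromℕ< _) ⟩
      n + n ∸ suc (n + j)       ≡⟨ cong (n + n ∸_) (sym (+-suc n j)) ⟩
      n + n ∸ (n + suc j)       ≡⟨ [m+n]∸[m+o]≡n∸o n n (suc j) ⟩
      n ∸ suc j                 ∎

  isBn⇒mirror : x ≡ mirror n (take n x)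
  isBn⇒mirror = begin
    x                   ≡⟨ sym (take++drop≡id n x) ⟩
    h ++ drop n x       ≡⟨ cong (h ++_) (nth-ext (drop n x) (barRev n h) (trans length-drop-n (sym length-barRev-h)) secondHalf) ⟩
    h ++ barRev n h     ∎
    where
    open ≡-Reasoning
    h = take n x
    length-drop-n : length (drop n x) ≡ n
    length-drop-n = trans (length-drop n x) (trans (cong (_∸ n) length≡n+n) (m+n∸m≡n n n))
    length-barRev-h : length (barRev n h) ≡ n
    length-barRev-h = trans (length-barRev n h) length-take-isBn
    nth-x : ∀ {i} → i < n → nth x i ≡ nth h i
    nth-x {i} i<n = trans (cong (λ l → nth l i) (sym (take++drop≡id n x)))
                          (nth-++ˡ h _ (subst (i <_) (sym length-take-isBn) i<n))
    nth-drop : ∀ j → nth (drop n x) j ≡ nth x (n + j)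
    nth-drop j = sym (trans (cong (λ l → nth l (n + j)) (sym (take++drop≡id n x)))
                            (trans (cong (λ m → nth (h ++ drop n x) (m + j)) (sym length-take-isBn)) (nth-++ʳ h _ j)))
    secondHalf : ∀ {j} → j < length (drop n x) → nth (drop n x) j ≡ nth (barRev n h) j
    secondHalf {j} j< = begin
      nth (drop n x) j                           ≡⟨ nth-drop j ⟩
      nth x (n + j)                              ≡⟨ sym (m+n∸n≡m _ (nth x (n ∸ suc j))) ⟩
      nth x (n + j) + nth x (n ∸ suc j) ∸ nth x (n ∸ suc j) ≡⟨ cong (_∸ nth x (n ∸ suc j)) (isBn-sym j<n) ⟩
      bar n (nth x (n ∸ suc j))                  ≡⟨ cong (bar n) (nth-x (reflect-< j<n)) ⟩
      bar n (nth h (n ∸ suc j))                  ≡⟨ cong (λ m → bar n (nth h (m ∸ suc j))) (sym length-take-isBn) ⟩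
      bar n (nth h (length h ∸ suc j))           ≡⟨ cong (bar n) (sym (nth-reverse h (subst (j <_) (sym length-take-isBn) j<n))) ⟩
      bar n (nth (reverse h) j)                  ≡⟨ sym (nth-map (bar n) (reverse h) (subst (j <_) (sym (trans (length-reverse h) length-take-isBn)) j<n)) ⟩
      nth (barRev n h) j                         ∎
      where
      j<n : j < n
      j<n = subst (j <_) length-drop-n j<

<bar⇒≤ : ∀ n {z} → z < bar n z → z ≤ n
<bar⇒≤ n {z} z<z̄ with z ≤? n
... | yes z≤n′ = z≤n′
... | no  z≰n  = contradiction (<-trans z<z̄ (≤-<-trans (<⇒bar≤ n (≰⇒> z≰n)) (≰⇒> z≰n))) (<-irrefl refl)

mirror-noPair : ∀ n h → All (InRange n) h → Unique (mirror n h) → ∀ {z} → z ∈ h → bar n z ∉ h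
mirror-noPair n h hr u {z} z∈ z̄∈ = disjoint h (barRev n h) u z∈
  (subst (_∈ barRev n h) (bar-involutive n (InRange⇒≤2n+1 n (All.lookup hr z∈))) (∈-map⁺ (bar n) (Any.reverse⁺ z̄∈)))
  where
  disjoint : ∀ l t {v} → Unique (l ++ t) → v ∈ l → v ∉ t
  disjoint (a ∷ l) t (a∉ ∷ _) (here refl) v∈t = All.lookup a∉ (∈-++⁺ʳ l v∈t) refl
  disjoint (a ∷ l) t (_ ∷ u) (there v∈l) v∈t = disjoint l t u v∈l v∈t

barRev-snoc : ∀ n l z → barRev n (l ++ [ z ]) ≡ bar n z ∷ barRev n l
barRev-snoc n l z = cong (map (bar n)) (reverse-++ l [ z ])

barRev-∷ : ∀ n z l → barRev n (z ∷ l) ≡ barRev n l ++ [ bar n z ]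
barRev-∷ n z l = trans (cong (map (bar n)) (unfold-reverse z l)) (map-++ (bar n) (reverse l) [ z ])

barRev-++-last : ∀ n A {B b} → head B ≡ just b → ∃[ B′ ] ∃[ z ] (B ≡ B′ ++ [ z ] × barRev n (A ++ B) ≡ bar n z ∷ barRev n (A ++ B′))
barRev-++-last n A {B} hB with initLast B
... | [] with () ← hB
... | B′ ∷ʳ′ z = B′ , z , refl , trans (cong (barRev n) (sym (++-assoc A B′ [ z ]))) (barRev-snoc n (A ++ B′) z)

Increasing-barRev : ∀ n {l} → Increasing l → All (_≤ suc (2 * n)) l → Increasing (barRev n l)
Increasing-barRev n {[]}    _            _          = []
Increasing-barRev n {x ∷ l} (x< ∷ inc) (x≤ ∷ l≤) rewrite unfold-reverse x l | map-++ (bar n) (reverse l) [ x ] =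
  AllPairs.++⁺ (Increasing-barRev n inc l≤) ([] ∷ []) (All.tabulate λ z∈ → below z∈ ∷ [])
  where
  below : ∀ {z} → z ∈ barRev n l → z < bar n x
  below z∈ with w , w∈ , refl ← ∈-map⁻ (bar n) z∈ =
    ∸-monoʳ-< (All.lookup x< (Any.reverse⁻ w∈)) (All.lookup l≤ (Any.reverse⁻ w∈))

Increasing-small++barRev : ∀ n {B} → Increasing B → All (_≤ n) B → Increasing (B ++ barRev n B)
Increasing-small++barRev n {B} incB B≤n =
  AllPairs.++⁺ incB (Increasing-barRev n incB (All.map (λ z≤ → ≤-trans z≤ (n≤2n+1 n)) B≤n))
    (All.tabulate λ z∈ → All.tabulate λ w∈ → small<barRev (All.lookup B≤n z∈) w∈)
  where
  small<barRev : ∀ {z w} → z ≤ n → w ∈ barRev n B → z < w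
  small<barRev z≤ w∈ with u , u∈ , refl ← ∈-map⁻ (bar n) w∈ = ≤-<-trans z≤ (≤⇒<bar n (All.lookup B≤n (Any.reverse⁻ u∈)))

-- Pop

popAux-reverse : ∀ {s} → Reverse s → ∀ {a as} rest → Linked _<_ (s ++ a ∷ as) →
  Connected _≤_ (head (s ++ a ∷ as)) (head rest) → popAux (a ∷ as) (reverse s ++ rest) ≡ s ++ a ∷ as ++ pop rest
popAux-reverse [] {a} {as} []      _ _          = sym (++-identityʳ (a ∷ as))
popAux-reverse []          (e ∷ r) _ (just a≤e) rewrite ≤⇒<ᵇ≡false a≤e = refl
popAux-reverse (s ∶ v ∶ʳ x) {a} {as} rest asc guard
  rewrite reverse-++ s [ x ] | ++-assoc s [ x ] (a ∷ as) | <⇒<ᵇ≡true (Linked-middle s asc)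
  = trans (popAux-reverse v rest asc guard) (sym (++-assoc s [ x ] _))

pop-reverse-ascending : ∀ s rest → Linked _<_ s → Connected _≤_ (head s) (head rest) →
  pop (reverse s ++ rest) ≡ s ++ pop rest
pop-reverse-ascending s rest = go (reverseView s)
  where
  go : ∀ {s} → Reverse s → Linked _<_ s → Connected _≤_ (head s) (head rest) → pop (reverse s ++ rest) ≡ s ++ pop rest
  go []             _   _     = refl
  go (s ∶ v ∶ʳ x) asc guard rewrite reverse-++ s [ x ] =
    trans (popAux-reverse v rest asc guard) (sym (++-assoc s [ x ] _))

pop-reverse-Linked : ∀ s → Linked _<_ s → pop (reverse s) ≡ s
pop-reverse-Linked []      _   = refl
pop-reverse-Linked (x ∷ s) asc = begin
  pop (reverse (x ∷ s))        ≡⟨ cong pop (sym (++-identityʳ (reverse (x ∷ s)))) ⟩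
  pop (reverse (x ∷ s) ++ [])  ≡⟨ pop-reverse-ascending (x ∷ s) [] asc just-nothing ⟩
  (x ∷ s) ++ []                ≡⟨ ++-identityʳ (x ∷ s) ⟩
  x ∷ s                        ∎
  where open ≡-Reasoning

-- The largest letter of the increasing run at the front of a word (0 for the empty word).
runTop : List ℕ → ℕ
runTop []          = 0
runTop (q ∷ [])    = q
runTop (q ∷ r ∷ l) = if q <ᵇ r then runTop (r ∷ l) else q

runTop-≥ : ∀ q l → q ≤ runTop (q ∷ l)
runTop-≥ q []      = ≤-refl
runTop-≥ q (r ∷ l) with q <ᵇ r in eq
... | true  = ≤-trans (<⇒≤ (<ᵇ≡true⇒< eq)) (runTop-≥ r l)
... | false = ≤-refl

runTop-∈ : ∀ q l → runTop (q ∷ l) ∈ q ∷ l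
runTop-∈ q []      = here refl
runTop-∈ q (r ∷ l) with q <ᵇ r
... | true  = there (runTop-∈ r l)
... | false = here refl

runTop-descent : ∀ s {t r₀} r → Linked _<_ (s ++ [ t ]) → r₀ < t → runTop (s ++ t ∷ r₀ ∷ r) ≡ t
runTop-descent []          r _           r₀<t rewrite ≤⇒<ᵇ≡false (<⇒≤ r₀<t) = refl
runTop-descent (x ∷ [])    r (x<t ∷ _)   r₀<t rewrite <⇒<ᵇ≡true x<t = runTop-descent [] r [-] r₀<t
runTop-descent (x ∷ y ∷ s) r (x<y ∷ asc) r₀<t rewrite <⇒<ᵇ≡true x<y = runTop-descent (y ∷ s) r asc r₀<t

data AscendingTo (L : ℕ) : List ℕ → Set where
  [-] : AscendingTo L [ L ]
  _∷_ : ∀ {x y l} → x < y → AscendingTo L (y ∷ l) → AscendingTo L (x ∷ y ∷ l)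

AscendingTo⇒≤runTop : ∀ {L s} → AscendingTo L s → ∀ r → L ≤ runTop (s ++ r)
AscendingTo⇒≤runTop {L} [-] r = runTop-≥ L r
AscendingTo⇒≤runTop (x<y ∷ asc) r rewrite <⇒<ᵇ≡true x<y = AscendingTo⇒≤runTop asc r

-- popAux only prepends smaller letters to the current run, so the run it
-- finally emits still climbs to the last letter of the initial one.
popAux-climbs : ∀ {L} acc xs → AscendingTo L acc → L ≤ runTop (popAux acc xs)
popAux-climbs acc [] asc = subst (λ l → _ ≤ runTop l) (++-identityʳ acc) (AscendingTo⇒≤runTop asc [])
popAux-climbs (a ∷ acc) (b ∷ xs) asc with b <ᵇ a in eq
... | true  = popAux-climbs (b ∷ a ∷ acc) xs (<ᵇ≡true⇒< eq ∷ asc)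
... | false = AscendingTo⇒≤runTop asc (popAux [ b ] xs)

split-at-descent : ∀ s {r} pre {p q} post → Linked _<_ s → s ++ r ≡ pre ++ p ∷ q ∷ post → q < p →
  (s ≡ pre ++ [ p ] × r ≡ q ∷ post) ⊎ ∃[ pre′ ] (pre ≡ s ++ pre′ × r ≡ pre′ ++ p ∷ q ∷ post)
split-at-descent []          pre       post _           eq   _   = inj₂ (pre , refl , eq)
split-at-descent (x ∷ [])    []        post _           refl _   = inj₁ (refl , refl)
split-at-descent (x ∷ [])    (y ∷ pre) post _           refl _   = inj₂ (pre , refl , refl)
split-at-descent (x ∷ y ∷ s) []        post (x<y ∷ _)   refl q<p = ⊥-elim (<-asym x<y q<p)
split-at-descent (x ∷ y ∷ s) (z ∷ pre) post (_ ∷ asc) eq q<p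
  with refl , eq′ ← ∷-injective eq
  with split-at-descent (y ∷ s) pre post asc eq′ q<p
... | inj₁ (eq₁ , eq₂)         = inj₁ (cong (x ∷_) eq₁ , eq₂)
... | inj₂ (pre′ , eq₁ , eq₂) = inj₂ (pre′ , cong (x ∷_) eq₁ , eq₂)

-- A descent p > q of pop y separates two runs of y: the smallest letter a of
-- the run ending in p is at most the first letter of the next run, and that
-- letter is the top of an increasing run of pop y starting at q.
popAux-descent : ∀ acc ys pre {p q} post → Linked _<_ acc → popAux acc ys ≡ pre ++ p ∷ q ∷ post → q < p →
  ∃[ a ] (a ∈ pre ++ [ p ] × a ≤ runTop (q ∷ post))
popAux-descent acc [] pre post asc eq q<p = ⊥-elim (<-asym (Linked-middle pre (subst (Linked _<_) eq asc)) q<p)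
popAux-descent [] (b ∷ xs) pre post _ eq q<p = popAux-descent [ b ] xs pre post [-] eq q<p
popAux-descent (a ∷ acc) (b ∷ xs) pre post asc eq q<p with b <ᵇ a in b<ᵇa
... | true = popAux-descent (b ∷ a ∷ acc) xs pre post (<ᵇ≡true⇒< b<ᵇa ∷ asc) eq q<p
... | false with split-at-descent (a ∷ acc) pre post asc eq q<p
...   | inj₁ (eq₁ , eq₂) =
  a , subst (a ∈_) eq₁ (here refl) ,
  ≤-trans (<ᵇ≡false⇒≥ b<ᵇa) (subst (λ l → b ≤ runTop l) eq₂ (popAux-climbs [ b ] xs [-]))
...   | inj₂ (pre′ , refl , eq₂) with a′ , a′∈ , a′≤ ← popAux-descent [ b ] xs pre′ post [-] eq₂ q<p =
  a′ , subst (a′ ∈_) (sym (++-assoc (a ∷ acc) pre′ _)) (∈-++⁺ʳ (a ∷ acc) a′∈) , a′≤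

pop-descent : ∀ y pre {p q} post → pop y ≡ pre ++ p ∷ q ∷ post → q < p →
  ∃[ a ] (a ∈ pre ++ [ p ] × a ≤ runTop (q ∷ post))
pop-descent y pre post = popAux-descent [] y pre post []

ascents-≤ : ∀ a l → ascents (a ∷ l) ≤ length l
ascents-≤ a []      = z≤n
ascents-≤ a (b ∷ l) with a <ᵇ b
... | true  = s≤s (ascents-≤ b l)
... | false = m≤n⇒m≤1+n (ascents-≤ b l)

Linked⇒ascents≡length : ∀ a l → Linked _<_ (a ∷ l) → ascents (a ∷ l) ≡ length l
Linked⇒ascents≡length a []      _           = refl
Linked⇒ascents≡length a (b ∷ l) (a<b ∷ asc) rewrite <⇒<ᵇ≡true a<b = cong suc (Linked⇒ascents≡length b l asc)

ascents≡length⇒Linked : ∀ a l → ascents (a ∷ l) ≡ length l → Linked _<_ (a ∷ l)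
ascents≡length⇒Linked a []      _  = [-]
ascents≡length⇒Linked a (b ∷ l) eq with a <ᵇ b in a<ᵇb
... | true  = <ᵇ≡true⇒< a<ᵇb ∷ ascents≡length⇒Linked b l (suc-injective eq)
... | false = contradiction (subst (_≤ length l) eq (ascents-≤ b l)) (<-irrefl refl)

ascents-descent : ∀ pre {p q} post → Linked _<_ (pre ++ [ p ]) → q < p →
  ascents (pre ++ p ∷ q ∷ post) ≡ length pre + ascents (q ∷ post)
ascents-descent []          post _           q<p rewrite ≤⇒<ᵇ≡false (<⇒≤ q<p) = refl
ascents-descent (x ∷ [])    post (x<p ∷ _)   q<p rewrite <⇒<ᵇ≡true x<p = cong suc (ascents-descent [] post [-] q<p)
ascents-descent (x ∷ y ∷ l) post (x<y ∷ asc) q<p rewrite <⇒<ᵇ≡true x<y = cong suc (ascents-descent (y ∷ l) post asc q<p)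

record SingleDescent (w : List ℕ) : Set where
  field
    pre        : List ℕ
    p q        : ℕ
    post       : List ℕ
    split      : w ≡ pre ++ p ∷ q ∷ post
    ascendingˡ : Linked _<_ (pre ++ [ p ])
    ascendingʳ : Linked _<_ (q ∷ post)
    descent    : q < p

singleDescent : ∀ w → Unique w → suc (ascents w) ≡ length w ∸ 1 → SingleDescent w
singleDescent (a ∷ b ∷ r) (a∉ ∷ u) eq with a <ᵇ b in a<ᵇb
... | false = record
  { pre = [] ; p = a ; q = b ; post = r ; split = refl ; ascendingˡ = [-]
  ; ascendingʳ = ascents≡length⇒Linked b r (suc-injective eq)
  ; descent = ≤∧≢⇒< (<ᵇ≡false⇒≥ a<ᵇb) (λ b≡a → All.head a∉ (sym b≡a)) }
... | true = record
  { pre = a ∷ pre ; p = p ; q = q ; post = post ; split = cong (a ∷_) split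
  ; ascendingˡ = extend pre split ascendingˡ ; ascendingʳ = ascendingʳ ; descent = descent }
  where
  open SingleDescent (singleDescent (b ∷ r) u (suc-injective eq))
  extend : ∀ pre {p q post} → b ∷ r ≡ pre ++ p ∷ q ∷ post → Linked _<_ (pre ++ [ p ]) → Linked _<_ (a ∷ pre ++ [ p ])
  extend []      refl asc = <ᵇ≡true⇒< a<ᵇb ∷ asc
  extend (_ ∷ _) refl asc = <ᵇ≡true⇒< a<ᵇb ∷ asc

-- Mirror words with a single descent

-- The swapped word consists of the reversed increasing runs A₀, B₀ ++ barRev B₀
-- and barRev A₀; b ≤ ā keeps them from merging under pop.
pop-mirror-swap : ∀ n {A₀ B₀ a b} → head A₀ ≡ just a → head B₀ ≡ just b → Increasing A₀ → Increasing B₀ →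
  All (_≤ suc (2 * n)) A₀ → All (_≤ n) B₀ → b ≤ bar n a →
  pop (mirror n (reverse A₀ ++ map (bar n) B₀)) ≡ mirror n (A₀ ++ B₀)
pop-mirror-swap n {a ∷ A} {b ∷ B} refl refl incA incB A≤ B≤n b≤ā = begin
  pop (mirror n (reverse A₀ ++ map (bar n) B₀))    ≡⟨ cong pop (mirror-swapped-runs n A₀ B≤) ⟩
  pop (reverse A₀ ++ reverse M ++ reverse N)       ≡⟨ pop-reverse-ascending A₀ _ (AllPairs⇒Linked incA) guardᴬ ⟩
  A₀ ++ pop (reverse M ++ reverse N)               ≡⟨ cong (A₀ ++_) (pop-reverse-ascending M _ (AllPairs⇒Linked incM) guardᴹ) ⟩
  A₀ ++ M ++ pop (reverse N)                       ≡⟨ cong (λ l → A₀ ++ M ++ l) (pop-reverse-Linked N (AllPairs⇒Linked incN)) ⟩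
  A₀ ++ M ++ N                                     ≡⟨ sym (mirror-runs n A₀ B₀) ⟩
  mirror n (A₀ ++ B₀)                              ∎
  where
  open ≡-Reasoning
  A₀ = a ∷ A
  B₀ = b ∷ B
  M = B₀ ++ barRev n B₀
  N = barRev n A₀
  B≤ : All (_≤ suc (2 * n)) B₀
  B≤ = All.map (λ z≤ → ≤-trans z≤ (n≤2n+1 n)) B≤n
  incM = Increasing-small++barRev n incB B≤n
  incN = Increasing-barRev n incA A≤
  guardᴬ : Connected _≤_ (just a) (head (reverse M ++ reverse N))
  guardᴬ rewrite reverse-mirror n B₀ = just (subst (_≤ bar n b) (bar-involutive n (All.head A≤)) (∸-monoʳ-≤ (suc (2 * n)) b≤ā))
  guardᴹ : Connected _≤_ (just b) (head (reverse N))
  guardᴹ rewrite reverse-barRev n A₀ = just b≤ā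

upperCovers-singleDescent : ∀ n pre {p b} post {t} rest → length (pre ++ p ∷ b ∷ post) ≡ n →
  Linked _<_ (pre ++ [ p ]) → Linked _<_ (b ∷ post ++ [ t ]) → b < p →
  upperCovers n ((pre ++ p ∷ b ∷ post) ++ t ∷ rest) ≡ n ∸ 1
upperCovers-singleDescent n pre {p} {b} post {t} rest refl ascˡ ascʳ b<p = begin
  ascents (take (suc (length w)) (w ++ t ∷ rest))     ≡⟨ cong (λ m → ascents (take m (w ++ t ∷ rest))) (+-comm 1 (length w)) ⟩
  ascents (take (length w + 1) (w ++ t ∷ rest))       ≡⟨ cong ascents (take-length-++ w (t ∷ rest) 1) ⟩
  ascents (w ++ [ t ])                                ≡⟨ cong ascents (++-assoc pre (p ∷ b ∷ post) [ t ]) ⟩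
  ascents (pre ++ p ∷ b ∷ post ++ [ t ])              ≡⟨ ascents-descent pre (post ++ [ t ]) ascˡ b<p ⟩
  length pre + ascents (b ∷ post ++ [ t ])            ≡⟨ cong (length pre +_) (Linked⇒ascents≡length b _ ascʳ) ⟩
  length pre + length (post ++ [ t ])                 ≡⟨ cong (length pre +_) (trans (length-++ post) (+-comm _ 1)) ⟩
  length pre + suc (length post)                      ≡⟨ sym (cong (_∸ 1) (trans (length-++ pre) (+-suc _ _))) ⟩
  length w ∸ 1                                        ∎
  where
  open ≡-Reasoning
  w = pre ++ p ∷ b ∷ post

upperCovers-mirror : ∀ n {A B a b} → head A ≡ just a → head B ≡ just b → Increasing A → Increasing B →
  All (n <_) A → All (_≤ n) B → length (A ++ B) ≡ n → upperCovers n (mirror n (A ++ B)) ≡ n ∸ 1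
upperCovers-mirror n {A} {b ∷ post} {b = b} hA refl incA incB A> B≤n lenAB with initLast A
... | [] with () ← hA
... | pre ∷ʳ′ p with B′ , z , B≡ , barRev≡ ← barRev-++-last n (pre ++ [ p ]) {b ∷ post} refl = begin
  upperCovers n (((pre ++ [ p ]) ++ b ∷ post) ++ barRev n ((pre ++ [ p ]) ++ b ∷ post))
    ≡⟨ cong₂ (λ l l′ → upperCovers n (l ++ l′)) (++-assoc pre [ p ] (b ∷ post)) barRev≡ ⟩
  upperCovers n ((pre ++ p ∷ b ∷ post) ++ bar n z ∷ barRev n ((pre ++ [ p ]) ++ B′))
    ≡⟨ upperCovers-singleDescent n pre post _ (trans (cong length (sym (++-assoc pre [ p ] (b ∷ post)))) lenAB)
         (AllPairs⇒Linked incA) (AllPairs⇒Linked incB++z̄) b<p ⟩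
  n ∸ 1 ∎
  where
  open ≡-Reasoning
  z̄>n : n < bar n z
  z̄>n = ≤⇒<bar n (All.lookup B≤n (subst (z ∈_) (sym B≡) (∈-++⁺ʳ B′ (here refl))))
  incB++z̄ : Increasing ((b ∷ post) ++ [ bar n z ])
  incB++z̄ = AllPairs.++⁺ incB ([] ∷ []) (All.map (λ z≤ → ≤-<-trans z≤ z̄>n ∷ []) B≤n)
  b<p : b < p
  b<p = ≤-<-trans (All.head B≤n) (All.lookup A> (∈-++⁺ʳ pre (here refl)))

-- The run from q climbs through B and the complements of B up to q̄, which is followed by p̄ < q̄.
runTop-small-barRev : ∀ n pre {p q} B → Increasing (q ∷ B) → All (_≤ n) (q ∷ B) → q < p → p ≤ suc (2 * n) →
  runTop ((q ∷ B) ++ barRev n ((pre ++ [ p ]) ++ q ∷ B)) ≡ bar n q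
runTop-small-barRev n pre {p} {q} B inc B≤n q<p p≤ = begin
  runTop ((q ∷ B) ++ barRev n ((pre ++ [ p ]) ++ q ∷ B))             ≡⟨ cong (λ l → runTop ((q ∷ B) ++ l)) layout ⟩
  runTop ((q ∷ B) ++ (barRev n B ++ [ bar n q ]) ++ bar n p ∷ barRev n pre)
    ≡⟨ cong runTop (trans (cong ((q ∷ B) ++_) (++-assoc (barRev n B) [ bar n q ] _)) (sym (++-assoc (q ∷ B) (barRev n B) _))) ⟩
  runTop (((q ∷ B) ++ barRev n B) ++ bar n q ∷ bar n p ∷ barRev n pre)
    ≡⟨ runTop-descent ((q ∷ B) ++ barRev n B) (barRev n pre) (AllPairs⇒Linked increasing) (∸-monoʳ-< q<p p≤) ⟩
  bar n q ∎
  where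
  open ≡-Reasoning
  layout : barRev n ((pre ++ [ p ]) ++ q ∷ B) ≡ (barRev n B ++ [ bar n q ]) ++ bar n p ∷ barRev n pre
  layout = begin
    map (bar n) (reverse ((pre ++ [ p ]) ++ q ∷ B))                ≡⟨ cong (map (bar n)) (reverse-++ (pre ++ [ p ]) (q ∷ B)) ⟩
    map (bar n) (reverse (q ∷ B) ++ reverse (pre ++ [ p ]))        ≡⟨ map-++ (bar n) (reverse (q ∷ B)) _ ⟩
    barRev n (q ∷ B) ++ barRev n (pre ++ [ p ])                    ≡⟨ cong₂ _++_ (barRev-∷ n q B) (barRev-snoc n pre p) ⟩
    (barRev n B ++ [ bar n q ]) ++ bar n p ∷ barRev n pre          ∎
  increasing : Increasing (((q ∷ B) ++ barRev n B) ++ [ bar n q ])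
  increasing = subst Increasing (trans (cong ((q ∷ B) ++_) (barRev-∷ n q B)) (sym (++-assoc (q ∷ B) (barRev n B) _)))
                     (Increasing-small++barRev n inc B≤n)

-- The first half of the words being counted: for a set S ⊆ {1,…,k} given by
-- its indicator f, bigPart lists the complements v̄ (v ∈ S) increasingly and
-- smallPart lists {1,…,k} ∖ S increasingly.
bigPart : ℕ → (ℕ → Bool) → ℕ → List ℕ
bigPart n f zero    = []
bigPart n f (suc k) = (if f (suc k) then [ bar n (suc k) ] else []) ++ bigPart n f k

smallPart : (ℕ → Bool) → ℕ → List ℕ
smallPart f zero    = []
smallPart f (suc k) = smallPart f k ++ (if f (suc k) then [] else [ suc k ])

firstHalf : ℕ → (ℕ → Bool) → List ℕ
firstHalf n f = bigPart n f n ++ smallPart f n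

module _ (f : ℕ → Bool) where

  ∈-smallPart⁻ : ∀ k {z} → z ∈ smallPart f k → 1 ≤ z × z ≤ k × f z ≡ false
  ∈-smallPart⁻ (suc k) z∈ with ∈-++⁻ (smallPart f k) z∈
  ... | inj₁ z∈′ with 1≤z , z≤k , fz ← ∈-smallPart⁻ k z∈′ = 1≤z , m≤n⇒m≤1+n z≤k , fz
  ... | inj₂ z∈′ with f (suc k) in fk | z∈′
  ...   | false | here refl = s≤s z≤n , ≤-refl , fk

  ∈-smallPart⁺ : ∀ k {v} → 1 ≤ v → v ≤ k → f v ≡ false → v ∈ smallPart f k
  ∈-smallPart⁺ zero    (s≤s _) ()
  ∈-smallPart⁺ (suc k) {v} 1≤v v≤k fv with m≤n⇒m<n∨m≡n v≤k
  ... | inj₂ refl rewrite fv = ∈-++⁺ʳ (smallPart f k) (here refl)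
  ... | inj₁ v<k = ∈-++⁺ˡ (∈-smallPart⁺ k 1≤v (s≤s⁻¹ v<k) fv)

  Increasing-smallPart : ∀ k → Increasing (smallPart f k)
  Increasing-smallPart zero = []
  Increasing-smallPart (suc k) with f (suc k)
  ... | true  = subst Increasing (sym (++-identityʳ (smallPart f k))) (Increasing-smallPart k)
  ... | false = AllPairs.++⁺ (Increasing-smallPart k) ([] ∷ [])
                  (All.tabulate λ z∈ → s≤s (proj₁ (proj₂ (∈-smallPart⁻ k z∈))) ∷ [])

module _ (n : ℕ) (f : ℕ → Bool) where

  length-parts : ∀ k → length (bigPart n f k) + length (smallPart f k) ≡ k
  length-parts zero = refl
  length-parts (suc k) with f (suc k)
  ... | true  = cong suc (trans (cong (length (bigPart n f k) +_) (trans (length-++ (smallPart f k)) (+-identityʳ _))) (length-parts k))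
  ... | false = trans (cong (length (bigPart n f k) +_) (trans (length-++ (smallPart f k)) (+-comm _ 1)))
                      (trans (+-suc _ _) (cong suc (length-parts k)))

  ∈-bigPart⁻ : ∀ k {z} → z ∈ bigPart n f k → ∃[ v ] (1 ≤ v × v ≤ k × f v ≡ true × z ≡ bar n v)
  ∈-bigPart⁻ (suc k) z∈ with f (suc k) in fk | z∈
  ... | true  | here refl = suc k , s≤s z≤n , ≤-refl , fk , refl
  ... | true  | there z∈′ with v , 1≤v , v≤k , fv , refl ← ∈-bigPart⁻ k z∈′ = v , 1≤v , m≤n⇒m≤1+n v≤k , fv , refl
  ... | false | z∈′       with v , 1≤v , v≤k , fv , refl ← ∈-bigPart⁻ k z∈′ = v , 1≤v , m≤n⇒m≤1+n v≤k , fv , refl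

  ∈-bigPart⁺ : ∀ k {v} → 1 ≤ v → v ≤ k → f v ≡ true → bar n v ∈ bigPart n f k
  ∈-bigPart⁺ zero    (s≤s _) ()
  ∈-bigPart⁺ (suc k) {v} 1≤v v≤k fv with m≤n⇒m<n∨m≡n v≤k
  ... | inj₂ refl rewrite fv = here refl
  ... | inj₁ v<k = ∈-++⁺ʳ (if f (suc k) then _ else []) (∈-bigPart⁺ k 1≤v (s≤s⁻¹ v<k) fv)

  Increasing-bigPart : ∀ k → k ≤ 2 * n → Increasing (bigPart n f k)
  Increasing-bigPart zero    _ = []
  Increasing-bigPart (suc k) k≤ with f (suc k)
  ... | false = Increasing-bigPart k (m+n≤o⇒n≤o 1 k≤)
  ... | true  = All.tabulate below ∷ Increasing-bigPart k (m+n≤o⇒n≤o 1 k≤)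
    where
    below : ∀ {z} → z ∈ bigPart n f k → bar n (suc k) < z
    below z∈ with v , _ , v≤k , _ , refl ← ∈-bigPart⁻ k z∈ = ∸-monoʳ-< (s≤s v≤k) (m≤n⇒m≤1+n k≤)

  bigPart-big : ∀ {z} → z ∈ bigPart n f n → n < z × z ≤ 2 * n
  bigPart-big z∈ with v , 1≤v , v≤n , _ , refl ← ∈-bigPart⁻ n z∈ =
    ≤⇒<bar n v≤n , proj₂ (bar-InRange n (1≤v , ≤-trans v≤n (m≤m+n n _)))

  smallPart-small : ∀ {z} → z ∈ smallPart f n → 1 ≤ z × z ≤ n
  smallPart-small z∈ with 1≤z , z≤n′ , _ ← ∈-smallPart⁻ f n z∈ = 1≤z , z≤n′

  bigPart⇒chosen : ∀ {v} → v ≤ n → bar n v ∈ bigPart n f n → f v ≡ true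
  bigPart⇒chosen v≤n v̄∈ with u , _ , u≤n , fu , v̄≡ū ← ∈-bigPart⁻ n v̄∈
    rewrite bar-injective n (≤-trans v≤n (n≤2n+1 n)) (≤-trans u≤n (n≤2n+1 n)) v̄≡ū = fu

  private
    A = bigPart n f n
    B = smallPart f n

    A-InRange : All (InRange n) A
    A-InRange = All.tabulate λ z∈ → ≤-trans (s≤s z≤n) (proj₁ (bigPart-big z∈)) , proj₂ (bigPart-big z∈)

    B-InRange : All (InRange n) B
    B-InRange = All.tabulate λ z∈ → proj₁ (smallPart-small z∈) , ≤-trans (proj₂ (smallPart-small z∈)) (m≤m+n n _)

    A-Increasing : Increasing A
    A-Increasing = Increasing-bigPart n (m≤m+n n _)

    B-Increasing : Increasing B
    B-Increasing = Increasing-smallPart f n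

    small∉A : ∀ {z} → z ≤ n → z ∉ A
    small∉A z≤ z∈ = <-irrefl refl (≤-<-trans z≤ (proj₁ (bigPart-big z∈)))

    big∉B : ∀ {z} → n < z → z ∉ B
    big∉B n<z z∈ = <-irrefl refl (<-≤-trans n<z (proj₂ (smallPart-small z∈)))

  chosen⇔bar∈firstHalf : ∀ {v} → 1 ≤ v → v ≤ n → (f v ≡ true) ⇔ (bar n v ∈ firstHalf n f)
  chosen⇔bar∈firstHalf 1≤v v≤n = mk⇔ (λ fv → ∈-++⁺ˡ (∈-bigPart⁺ n 1≤v v≤n fv)) λ v̄∈ → case ∈-++⁻ A v̄∈ of λ where
    (inj₁ v̄∈A) → bigPart⇒chosen v≤n v̄∈A
    (inj₂ v̄∈B) → ⊥-elim (big∉B (≤⇒<bar n v≤n) v̄∈B)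

  length-firstHalf : length (firstHalf n f) ≡ n
  length-firstHalf = trans (length-++ A) (length-parts n)

  isBn-mirror-firstHalf : IsBn n (mirror n (firstHalf n f))
  isBn-mirror-firstHalf = isBn-mirror n (A ++ B) length-firstHalf (All.++⁺ A-InRange B-InRange)
    (Unique.++⁺ (Increasing⇒Unique A-Increasing) (Increasing⇒Unique B-Increasing) λ (z∈A , z∈B) → small∉A (proj₂ (smallPart-small z∈B)) z∈A)
    noComplementaryPair
    where
    noComplementaryPair : ∀ {z} → z ∈ A ++ B → bar n z ∉ A ++ B
    noComplementaryPair z∈ z̄∈ with ∈-++⁻ A z∈
    ... | inj₁ z∈A with v , _ , v≤n , fv , refl ← ∈-bigPart⁻ n z∈A
      rewrite bar-involutive n (≤-trans v≤n (n≤2n+1 n)) with ∈-++⁻ A z̄∈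
    ...   | inj₁ v∈A = small∉A v≤n v∈A
    ...   | inj₂ v∈B with () ← trans (sym fv) (proj₂ (proj₂ (∈-smallPart⁻ f n v∈B)))
    noComplementaryPair z∈ z̄∈ | inj₂ z∈B with 1≤z , z≤ , fz ← ∈-smallPart⁻ f n z∈B with ∈-++⁻ A z̄∈
    ... | inj₁ z̄∈A with () ← trans (sym fz) (bigPart⇒chosen z≤ z̄∈A)
    ... | inj₂ z̄∈B = big∉B (≤⇒<bar n z≤) z̄∈B

  isBn-mirror-swapped : IsBn n (mirror n (reverse (bigPart n f n) ++ map (bar n) (smallPart f n)))
  isBn-mirror-swapped = isBn-mirror n h′ length-h′ h′-InRange
    (Unique.++⁺ (Unique-reverse A (Increasing⇒Unique A-Increasing)) (Unique-map-bar n B-InRange (Increasing⇒Unique B-Increasing)) disjoint)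
    (λ z∈ z̄∈ → <-irrefl refl (<-≤-trans (h′-big z̄∈) (<⇒bar≤ n (h′-big z∈))))
    where
    h′ = reverse A ++ map (bar n) B
    length-h′ : length h′ ≡ n
    length-h′ = trans (length-++ (reverse A)) (trans (cong₂ _+_ (length-reverse A) (length-map (bar n) B)) (length-parts n))
    h′-InRange : All (InRange n) h′
    h′-InRange = All.++⁺ (All-reverse A-InRange) (All.map⁺ (All.map (bar-InRange n) B-InRange))
    h′-big : ∀ {z} → z ∈ h′ → n < z
    h′-big z∈ with ∈-++⁻ (reverse A) z∈
    ... | inj₁ z∈A = proj₁ (bigPart-big (Any.reverse⁻ z∈A))
    ... | inj₂ z∈B̄ with w , w∈ , refl ← ∈-map⁻ (bar n) z∈B̄ = ≤⇒<bar n (proj₂ (smallPart-small w∈))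
    disjoint : ∀ {z} → z ∈ reverse A × z ∈ map (bar n) B → ⊥
    disjoint (z∈A , z∈B̄) with w , w∈ , refl ← ∈-map⁻ (bar n) z∈B̄ with _ , w≤ , fw ← ∈-smallPart⁻ f n w∈
      with () ← trans (sym fw) (bigPart⇒chosen w≤ (Any.reverse⁻ z∈A))

nthV : ∀ {k} → Vec Bool k → ℕ → Bool
nthV []       _       = false
nthV (b ∷ bs) zero    = b
nthV (b ∷ bs) (suc j) = nthV bs j

nthV-ext : ∀ {k} (bs bs′ : Vec Bool k) → (∀ {j} → j < k → nthV bs j ≡ nthV bs′ j) → bs ≡ bs′
nthV-ext []       []         _  = refl
nthV-ext (b ∷ bs) (b′ ∷ bs′) pt = cong₂ _∷_ (pt (s≤s z≤n)) (nthV-ext bs bs′ (λ j< → pt (s≤s j<)))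

-- The indicator of {j + 1 : bs[j] = true} ∪ {k + 1}; nthV is false past the end.
indicator : ∀ {k} → Vec Bool k → ℕ → Bool
indicator bs v = nthV (bs ∷ʳ true) (v ∸ 1)

indicator-top : ∀ {k} (bs : Vec Bool k) → indicator bs (suc k) ≡ true
indicator-top []       = refl
indicator-top (b ∷ bs) = indicator-top bs

indicator-above : ∀ {k} (bs : Vec Bool k) {v} → suc k < v → indicator bs v ≡ false
indicator-above []       {suc zero}    (s≤s ())
indicator-above []       {suc (suc v)} _           = refl
indicator-above (b ∷ bs) {suc (suc v)} (s≤s k<v) = indicator-above bs k<v

indicator-below : ∀ {k} (bs : Vec Bool k) {j} → j < k → indicator bs (suc j) ≡ nthV bs j
indicator-below (b ∷ bs) {zero}  _         = refl
indicator-below (b ∷ bs) {suc j} (s≤s j<) = indicator-below bs j<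

allVecs : (k : ℕ) → List (Vec Bool k)
allVecs zero    = [ [] ]
allVecs (suc k) = map (false ∷_) (allVecs k) ++ map (true ∷_) (allVecs k)

properVecs : (k : ℕ) → List (Vec Bool k)
properVecs zero    = []
properVecs (suc k) = map (false ∷_) (allVecs k) ++ map (true ∷_) (properVecs k)

length-allVecs : ∀ k → length (allVecs k) ≡ 2 ^ k
length-allVecs zero    = refl
length-allVecs (suc k) = begin
  length (map (false ∷_) (allVecs k) ++ map (true ∷_) (allVecs k))  ≡⟨ length-++ (map (false ∷_) (allVecs k)) ⟩
  length (map (false ∷_) (allVecs k)) + length (map (true ∷_) (allVecs k))
    ≡⟨ cong₂ _+_ (trans (length-map _ (allVecs k)) (length-allVecs k)) (trans (length-map _ (allVecs k)) (length-allVecs k)) ⟩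
  2 ^ k + 2 ^ k                                                       ≡⟨ sym (2*n≡n+n (2 ^ k)) ⟩
  2 ^ suc k                                                           ∎
  where open ≡-Reasoning

length-properVecs : ∀ k → length (properVecs k) ≡ 2 ^ k ∸ 1
length-properVecs zero    = refl
length-properVecs (suc k) = begin
  length (map (false ∷_) (allVecs k) ++ map (true ∷_) (properVecs k))  ≡⟨ length-++ (map (false ∷_) (allVecs k)) ⟩
  length (map (false ∷_) (allVecs k)) + length (map (true ∷_) (properVecs k))
    ≡⟨ cong₂ _+_ (trans (length-map _ (allVecs k)) (length-allVecs k)) (trans (length-map _ (properVecs k)) (length-properVecs k)) ⟩
  2 ^ k + (2 ^ k ∸ 1)                                                   ≡⟨ sym (+-∸-assoc (2 ^ k) (m^n>0 2 k)) ⟩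
  2 ^ k + 2 ^ k ∸ 1                                                     ≡⟨ cong (_∸ 1) (sym (2*n≡n+n (2 ^ k))) ⟩
  2 ^ suc k ∸ 1                                                         ∎
  where open ≡-Reasoning

∈-allVecs : ∀ {k} (bs : Vec Bool k) → bs ∈ allVecs k
∈-allVecs []                = here refl
∈-allVecs (false ∷ bs)      = ∈-++⁺ˡ (∈-map⁺ (false ∷_) (∈-allVecs bs))
∈-allVecs {suc k} (true ∷ bs) = ∈-++⁺ʳ (map (false ∷_) (allVecs k)) (∈-map⁺ (true ∷_) (∈-allVecs bs))

∈-properVecs⁺ : ∀ {k} (bs : Vec Bool k) {j} → j < k → nthV bs j ≡ false → bs ∈ properVecs k
∈-properVecs⁺ (false ∷ bs) _ _ = ∈-++⁺ˡ (∈-map⁺ (false ∷_) (∈-allVecs bs))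
∈-properVecs⁺ {suc k} (true ∷ bs) {suc j} (s≤s j<) bj =
  ∈-++⁺ʳ (map (false ∷_) (allVecs k)) (∈-map⁺ (true ∷_) (∈-properVecs⁺ bs j< bj))

∈-properVecs⁻ : ∀ {k} {bs : Vec Bool k} → bs ∈ properVecs k → ∃[ j ] (j < k × nthV bs j ≡ false)
∈-properVecs⁻ {suc k} bs∈ with ∈-++⁻ (map (false ∷_) (allVecs k)) bs∈
... | inj₁ bs∈′ with _ , _ , refl ← ∈-map⁻ (false ∷_) bs∈′ = 0 , s≤s z≤n , refl
... | inj₂ bs∈′ with _ , bs′∈ , refl ← ∈-map⁻ (true ∷_) bs∈′
                with j , j< , bj ← ∈-properVecs⁻ bs′∈ = suc j , s≤s j< , bj

private
  Unique-++-heads : ∀ {k} {xs ys : List (Vec Bool k)} → Unique xs → Unique ys →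
    Unique (map (false ∷_) xs ++ map (true ∷_) ys)
  Unique-++-heads ux uy = Unique.++⁺ (Unique.map⁺ Vec.∷-injectiveʳ ux) (Unique.map⁺ Vec.∷-injectiveʳ uy) λ where
    (bs∈ , bs∈′) → case (∈-map⁻ (false ∷_) bs∈ , ∈-map⁻ (true ∷_) bs∈′) of λ where
      ((_ , _ , refl) , (_ , _ , ()))

Unique-allVecs : ∀ k → Unique (allVecs k)
Unique-allVecs zero    = [] ∷ []
Unique-allVecs (suc k) = Unique-++-heads (Unique-allVecs k) (Unique-allVecs k)

Unique-properVecs : ∀ k → Unique (properVecs k)
Unique-properVecs zero    = []
Unique-properVecs (suc k) = Unique-++-heads (Unique-allVecs k) (Unique-properVecs k)

complementBits : ℕ → List ℕ → (k : ℕ) → Vec Bool k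
complementBits n h k = tabulate λ j → does (bar n (suc (toℕ j)) ∈? h)

nthV-tabulate : ∀ {k} (g : ℕ → Bool) {j} → j < k → nthV (tabulate {n = k} (λ i → g (toℕ i))) j ≡ g j
nthV-tabulate {suc k} g {zero}  _         = refl
nthV-tabulate {suc k} g {suc j} (s≤s j<) = nthV-tabulate (λ i → g (suc i)) j<

-- The counted words

word : ∀ n {k} → Vec Bool k → List ℕ
word n bs = mirror n (firstHalf n (indicator bs))

module _ {n k} (bs : Vec Bool k) (k<n : k < n) where

  private
    f = indicator bs
    A = bigPart n f n
    B = smallPart f n

  bigPart-indicator : bigPart n f n ≡ bar n (suc k) ∷ bigPart n f k
  bigPart-indicator = trans (stable n k<n) (cong (λ b → (if b then [ bar n (suc k) ] else []) ++ bigPart n f k) (indicator-top bs))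
    where
    stable : ∀ t → k < t → bigPart n f t ≡ bigPart n f (suc k)
    stable t k<t with m≤n⇒m<n∨m≡n k<t
    ... | inj₂ refl = refl
    stable (suc t) _ | inj₁ k+1<t+1 rewrite indicator-above bs k+1<t+1 = stable t (s≤s⁻¹ k+1<t+1)

  head-word : head (word n bs) ≡ just (bar n (suc k))
  head-word = cong (λ A′ → head (mirror n (A′ ++ B))) bigPart-indicator

  module _ (bs∈ : bs ∈ properVecs k) where

    private
      hA : head A ≡ just (bar n (suc k))
      hA = cong head bigPart-indicator

      unchosen : ∃[ q ] (q ∈ B × q ≤ k)
      unchosen with j , j<k , bj ← ∈-properVecs⁻ bs∈ =
        suc j , ∈-smallPart⁺ f n (s≤s z≤n) (≤-trans j<k (<⇒≤ k<n)) (trans (indicator-below bs j<k) bj) , j<k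

      headB = Increasing⇒∃head≤ (Increasing-smallPart f n) (proj₁ (proj₂ unchosen))
      b = proj₁ headB
      hB : head B ≡ just b
      hB = proj₁ (proj₂ headB)
      b≤k : b ≤ k
      b≤k = ≤-trans (proj₂ (proj₂ headB)) (proj₂ (proj₂ unchosen))

      A-Increasing : Increasing A
      A-Increasing = Increasing-bigPart n f n (m≤m+n n _)

      B≤n : All (_≤ n) B
      B≤n = All.tabulate λ z∈ → proj₂ (smallPart-small n f z∈)

    word-inPopImage : InPopImage n (word n bs)
    word-inPopImage = isBn-mirror-firstHalf n f , _ , isBn-mirror-swapped n f ,
      pop-mirror-swap n hA hB A-Increasing (Increasing-smallPart f n)
        (All.tabulate λ z∈ → m≤n⇒m≤1+n (proj₂ (bigPart-big n f z∈))) B≤n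
        (subst (b ≤_) (sym (bar-involutive n (≤-trans k<n (n≤2n+1 n)))) (m≤n⇒m≤1+n b≤k))

    upperCovers-word : upperCovers n (word n bs) ≡ n ∸ 1
    upperCovers-word = upperCovers-mirror n hA hB A-Increasing (Increasing-smallPart f n)
      (All.tabulate λ z∈ → proj₁ (bigPart-big n f z∈)) B≤n (length-firstHalf n f)

word-injective : ∀ n {k} → k < n → {bs bs′ : Vec Bool k} → word n bs ≡ word n bs′ → bs ≡ bs′
word-injective n k<n {bs} {bs′} eq = nthV-ext bs bs′ λ {j} j<k → begin
  nthV bs j               ≡⟨ sym (indicator-below bs j<k) ⟩
  indicator bs (suc j)    ≡⟨ ⇔→≡ (same-chosen (s≤s z≤n) (≤-trans j<k (<⇒≤ k<n))) ⟩
  indicator bs′ (suc j)   ≡⟨ indicator-below bs′ j<k ⟩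
  nthV bs′ j              ∎
  where
  open ≡-Reasoning
  same-half : firstHalf n (indicator bs) ≡ firstHalf n (indicator bs′)
  same-half = begin
    firstHalf n (indicator bs)    ≡⟨ sym (take-mirror n _ (length-firstHalf n (indicator bs))) ⟩
    take n (word n bs)            ≡⟨ cong (take n) eq ⟩
    take n (word n bs′)           ≡⟨ take-mirror n _ (length-firstHalf n (indicator bs′)) ⟩
    firstHalf n (indicator bs′)   ∎
  same-chosen : ∀ {v} → 1 ≤ v → v ≤ n → (indicator bs v ≡ true) ⇔ (indicator bs′ v ≡ true)
  same-chosen 1≤v v≤n = ⇔.trans (subst (λ l → _ ⇔ (_ ∈ l)) same-half (chosen⇔bar∈firstHalf n (indicator bs) 1≤v v≤n))
                                (⇔.sym (chosen⇔bar∈firstHalf n (indicator bs′) 1≤v v≤n))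

-- The converse

record RunDecomposition (n m : ℕ) (x : List ℕ) : Set where
  field
    A B          : List ℕ
    x≡mirror     : x ≡ mirror n (A ++ B)
    length-A++B  : length (A ++ B) ≡ n
    InRange-A++B : All (InRange n) (A ++ B)
    noPair       : ∀ {z} → z ∈ A ++ B → bar n z ∉ A ++ B
    head-A       : head A ≡ just (bar n m)
    Increasing-A : Increasing A
    Increasing-B : Increasing B
    B-small      : All (_≤ n) B
    q            : ℕ
    q∈B          : q ∈ B
    q<m          : q < m

module _ {n k x y} (k<n : k < n) (bx : IsBn n x) (pop-y : pop y ≡ x)
         (head-x : head x ≡ just (bar n (suc k))) (covers-x : upperCovers n x ≡ n ∸ 1) where

  private
    i = bar n (suc k)
    n<i : n < i
    n<i = ≤⇒<bar n k<n
    h = take n x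
    length-h : length h ≡ n
    length-h = length-take-isBn bx
    0<n : 0 < n
    0<n = ≤-<-trans z≤n k<n
    x≡mirror : x ≡ mirror n h
    x≡mirror = isBn⇒mirror bx
    h-InRange : All (InRange n) h
    h-InRange = All.++⁻ˡ h (subst (All (InRange n)) x≡mirror (isBn⇒InRange bx))
    noPair : ∀ {z} → z ∈ h → bar n z ∉ h
    noPair = mirror-noPair n h h-InRange (subst Unique x≡mirror (isBn⇒Unique bx))
    head-h : head h ≡ just i
    head-h = trans (sym (head-++⁻ h (barRev n h) (subst (0 <_) (sym length-h) 0<n))) (trans (cong head (sym x≡mirror)) head-x)

    h-last = barRev-++-last n [] head-h
    t₀ = bar n (proj₁ (proj₂ h-last))
    tail₀ = barRev n (proj₁ h-last)
    barRev-h : barRev n h ≡ t₀ ∷ tail₀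
    barRev-h = proj₂ (proj₂ (proj₂ h-last))

    w = h ++ [ t₀ ]
    x≡w++tail₀ : x ≡ w ++ tail₀
    x≡w++tail₀ = trans x≡mirror (trans (cong (h ++_) barRev-h) (sym (++-assoc h [ t₀ ] tail₀)))
    take-x : take (suc n) x ≡ w
    take-x = begin
      take (suc n) x                          ≡⟨ cong₂ take (trans (+-comm 1 n) (cong (_+ 1) (sym length-h))) (trans x≡mirror (cong (h ++_) barRev-h)) ⟩
      take (length h + 1) (h ++ t₀ ∷ tail₀)   ≡⟨ take-length-++ h (t₀ ∷ tail₀) 1 ⟩
      w                                       ∎
      where open ≡-Reasoning
    ascents-w : suc (ascents w) ≡ length w ∸ 1
    ascents-w = begin
      suc (ascents w)           ≡⟨ cong (λ l → suc (ascents l)) (sym take-x) ⟩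
      suc (upperCovers n x)     ≡⟨ cong suc covers-x ⟩
      suc (n ∸ 1)               ≡⟨ suc-pred n {{>-nonZero 0<n}} ⟩
      n                         ≡⟨ sym (m+n∸n≡m n 1) ⟩
      n + 1 ∸ 1                 ≡⟨ cong (_∸ 1) (sym (trans (length-++ h) (cong (_+ 1) length-h))) ⟩
      length w ∸ 1              ∎
      where open ≡-Reasoning

    opaque
      singleDescent-w : SingleDescent w
      singleDescent-w = singleDescent w (subst Unique take-x (Unique.take⁺ (suc n) (isBn⇒Unique bx))) ascents-w
    open SingleDescent singleDescent-w

    A = pre ++ [ p ]
    x-descent : x ≡ pre ++ p ∷ q ∷ (post ++ tail₀)
    x-descent = trans x≡w++tail₀ (trans (cong (_++ tail₀) split) (++-assoc pre (p ∷ q ∷ post) tail₀))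

    pop-witness = pop-descent y pre (post ++ tail₀) (trans pop-y x-descent) descent
    a = proj₁ pop-witness
    a∈A : a ∈ A
    a∈A = proj₁ (proj₂ pop-witness)
    a≤runTop : a ≤ runTop (q ∷ post ++ tail₀)
    a≤runTop = proj₂ (proj₂ pop-witness)

    h-split = split-snoc h t₀ A (q ∷ post) (trans split (sym (++-assoc pre [ p ] (q ∷ post)))) (λ ())
    B = proj₁ h-split
    q∷post≡ : q ∷ post ≡ B ++ [ t₀ ]
    q∷post≡ = proj₁ (proj₂ h-split)
    h≡A++B : h ≡ A ++ B
    h≡A++B = proj₂ (proj₂ h-split)
    barRev-A++B : barRev n (A ++ B) ≡ t₀ ∷ tail₀
    barRev-A++B = subst (λ l → barRev n l ≡ t₀ ∷ tail₀) h≡A++B barRev-h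
    h-InRange′ : All (InRange n) (A ++ B)
    h-InRange′ = subst (All (InRange n)) h≡A++B h-InRange

    head-A : head A ≡ just i
    head-A = trans (sym (head-++⁻ A B (subst (0 <_) (sym (length-++ pre)) (m≤n+m 1 (length pre)))))
                   (trans (cong head (sym h≡A++B)) head-h)
    Increasing-A : Increasing A
    Increasing-A = Linked⇒AllPairs <-trans ascendingˡ
    i≤A : ∀ {z} → z ∈ A → i ≤ z
    i≤A = Increasing⇒head≤ head-A Increasing-A
    A-big : All (n <_) A
    A-big = All.tabulate λ z∈ → <-≤-trans n<i (i≤A z∈)

    -- Otherwise the run after the descent consists of complements of big letters, all ≤ n < a.
    B≢[] : B ≢ []
    B≢[] B≡[] = <-irrefl refl (<-≤-trans (<-≤-trans n<i (i≤A a∈A)) (≤-trans a≤runTop runTop≤n))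
      where
      h≡A : h ≡ A
      h≡A = trans h≡A++B (trans (cong (A ++_) B≡[]) (++-identityʳ A))
      run≡ : q ∷ post ++ tail₀ ≡ t₀ ∷ tail₀
      run≡ = cong (_++ tail₀) (trans q∷post≡ (cong (_++ [ t₀ ]) B≡[]))
      runTop∈ : runTop (q ∷ post ++ tail₀) ∈ barRev n h
      runTop∈ = subst (λ l → runTop l ∈ barRev n h) (sym run≡) (subst (runTop (t₀ ∷ tail₀) ∈_) (sym barRev-h) (runTop-∈ t₀ tail₀))
      runTop≤n : runTop (q ∷ post ++ tail₀) ≤ n
      runTop≤n with z , z∈ , eq ← ∈-map⁻ (bar n) runTop∈ =
        subst (_≤ n) (sym eq) (<⇒bar≤ n (All.lookup A-big (subst (z ∈_) h≡A (Any.reverse⁻ z∈))))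

    head-B : head B ≡ just q
    head-B = head-snoc B q∷post≡ B≢[]
    Increasing-B++t₀ : Increasing (B ++ [ t₀ ])
    Increasing-B++t₀ = subst Increasing q∷post≡ (Linked⇒AllPairs <-trans ascendingʳ)
    Increasing-B : Increasing B
    Increasing-B = Increasing-init B Increasing-B++t₀

    B-last = barRev-++-last n A head-B
    B₀ = proj₁ B-last
    z₀ = proj₁ (proj₂ B-last)
    B≡B₀++z₀ : B ≡ B₀ ++ [ z₀ ]
    B≡B₀++z₀ = proj₁ (proj₂ (proj₂ B-last))
    z₀≤n : z₀ ≤ n
    z₀≤n = <bar⇒≤ n (subst (z₀ <_) t₀≡z̄₀ (Increasing⇒<last B Increasing-B++t₀ (subst (z₀ ∈_) (sym B≡B₀++z₀) (∈-++⁺ʳ B₀ (here refl)))))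
      where
      t₀≡z̄₀ : t₀ ≡ bar n z₀
      t₀≡z̄₀ = proj₁ (∷-injective (trans (sym barRev-A++B) (proj₂ (proj₂ (proj₂ B-last)))))
    B-small : All (_≤ n) B
    B-small = All.tabulate λ z∈ → case ∈-++⁻ B₀ (subst (_ ∈_) B≡B₀++z₀ z∈) of λ where
      (inj₁ z∈B₀)        → <⇒≤ (<-≤-trans (Increasing⇒<last B₀ (subst Increasing B≡B₀++z₀ Increasing-B) z∈B₀) z₀≤n)
      (inj₂ (here refl)) → z₀≤n

    B′ = proj₁ (head⇒∷ head-B)
    B≡q∷B′ : B ≡ q ∷ B′
    B≡q∷B′ = proj₂ (head⇒∷ head-B)

    p∈h : p ∈ h
    p∈h = subst (p ∈_) (sym h≡A++B) (∈-++⁺ˡ (∈-++⁺ʳ pre (here refl)))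
    q∈B : q ∈ B
    q∈B = head⇒∈ head-B
    q∈h : q ∈ h
    q∈h = subst (q ∈_) (sym h≡A++B) (∈-++⁺ʳ A q∈B)

    runTop≡q̄ : runTop (q ∷ post ++ tail₀) ≡ bar n q
    runTop≡q̄ = begin
      runTop (q ∷ post ++ tail₀)      ≡⟨ cong (λ l → runTop (l ++ tail₀)) q∷post≡ ⟩
      runTop ((B ++ [ t₀ ]) ++ tail₀) ≡⟨ cong runTop (trans (++-assoc B [ t₀ ] tail₀) (cong (B ++_) (sym barRev-A++B))) ⟩
      runTop (B ++ barRev n (A ++ B)) ≡⟨ cong (λ l → runTop (l ++ barRev n (A ++ l))) B≡q∷B′ ⟩
      runTop ((q ∷ B′) ++ barRev n (A ++ q ∷ B′))
        ≡⟨ runTop-small-barRev n pre B′ (subst Increasing B≡q∷B′ Increasing-B) (subst (All (_≤ n)) B≡q∷B′ B-small) descent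
             (InRange⇒≤2n+1 n (All.lookup h-InRange p∈h)) ⟩
      bar n q                         ∎
      where open ≡-Reasoning

    q<m : q < suc k
    q<m = ∸-cancelʳ-< (≤∧≢⇒< i≤q̄ i≢q̄)
      where
      i≤q̄ : i ≤ bar n q
      i≤q̄ = ≤-trans (i≤A a∈A) (subst (a ≤_) runTop≡q̄ a≤runTop)
      i≢q̄ : i ≢ bar n q
      i≢q̄ i≡q̄ = noPair (head⇒∈ head-h)
                       (subst (_∈ h) (sym (trans (cong (bar n) i≡q̄) (bar-involutive n (InRange⇒≤2n+1 n (All.lookup h-InRange q∈h))))) q∈h)

  counted⇒runDecomposition : RunDecomposition n (suc k) x
  counted⇒runDecomposition = record
    { A = A ; B = B
    ; x≡mirror = trans x≡mirror (cong (mirror n) h≡A++B)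
    ; length-A++B = subst (λ l → length l ≡ n) h≡A++B length-h
    ; InRange-A++B = h-InRange′
    ; noPair = λ z∈ z̄∈ → noPair (subst (_ ∈_) (sym h≡A++B) z∈) (subst (_ ∈_) (sym h≡A++B) z̄∈)
    ; head-A = head-A
    ; Increasing-A = Increasing-A
    ; Increasing-B = Increasing-B
    ; B-small = B-small
    ; q = q ; q∈B = q∈B ; q<m = q<m
    }

module _ {n k x} (k<n : k < n) (decomposition : RunDecomposition n (suc k) x) where

  open RunDecomposition decomposition

  private
    h = A ++ B
    bs = complementBits n h k
    f = indicator bs

    f-below : ∀ {v} → 1 ≤ v → v < suc k → f v ≡ does (bar n v ∈? h)
    f-below {suc j} _ (s≤s j<k) = trans (indicator-below bs j<k) (nthV-tabulate (λ j → does (bar n (suc j) ∈? h)) j<k)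

    ≤2n+1 : ∀ {z} → z ∈ h → z ≤ suc (2 * n)
    ≤2n+1 z∈ = InRange⇒≤2n+1 n (All.lookup InRange-A++B z∈)

    A⊆bigPart : A ⊆ bigPart n f n
    A⊆bigPart {z} z∈ = subst (_∈ bigPart n f n) (bar-involutive n z≤) (∈-bigPart⁺ n f n 1≤z̄ (≤-trans z̄≤m k<n) chosen)
      where
      z≤ = ≤2n+1 (∈-++⁺ˡ z∈)
      1≤z̄ : 1 ≤ bar n z
      1≤z̄ = proj₁ (bar-InRange n (All.lookup InRange-A++B (∈-++⁺ˡ z∈)))
      z̄≤m : bar n z ≤ suc k
      z̄≤m = subst (bar n z ≤_) (bar-involutive n (≤-trans k<n (n≤2n+1 n))) (∸-monoʳ-≤ (suc (2 * n)) (Increasing⇒head≤ head-A Increasing-A z∈))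
      chosen : f (bar n z) ≡ true
      chosen with m≤n⇒m<n∨m≡n z̄≤m
      ... | inj₂ z̄≡m = subst (λ v → f v ≡ true) (sym z̄≡m) (indicator-top bs)
      ... | inj₁ z̄<m = trans (f-below 1≤z̄ z̄<m) (dec-true (bar n (bar n z) ∈? h) (subst (_∈ h) (sym (bar-involutive n z≤)) (∈-++⁺ˡ z∈)))

    bigPart⊆A : bigPart n f n ⊆ A
    bigPart⊆A z∈ with v , 1≤v , v≤n , fv , refl ← ∈-bigPart⁻ n f n z∈ with <-cmp v (suc k)
    ... | tri> _ _ m<v with () ← trans (sym fv) (indicator-above bs m<v)
    ... | tri≈ _ refl _ = head⇒∈ head-A
    ... | tri< v<m _ _ with bar n v ∈? h | f-below 1≤v v<m
    ...   | no _     | fv≡false with () ← trans (sym fv) fv≡false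
    ...   | yes v̄∈h | _ with ∈-++⁻ A v̄∈h
    ...     | inj₁ v̄∈A = v̄∈A
    ...     | inj₂ v̄∈B = contradiction (≤-<-trans (All.lookup B-small v̄∈B) (≤⇒<bar n v≤n)) (<-irrefl refl)

    B⊆smallPart : B ⊆ smallPart f n
    B⊆smallPart {z} z∈ = ∈-smallPart⁺ f n (proj₁ (All.lookup InRange-A++B z∈h)) (All.lookup B-small z∈) unchosen
      where
      z∈h = ∈-++⁺ʳ A z∈
      unchosen : f z ≡ false
      unchosen with <-cmp z (suc k)
      ... | tri> _ _ m<z = indicator-above bs m<z
      ... | tri≈ _ refl _ = contradiction (∈-++⁺ˡ (head⇒∈ head-A)) (noPair z∈h)
      ... | tri< z<m _ _ = trans (f-below (proj₁ (All.lookup InRange-A++B z∈h)) z<m) (dec-false (bar n z ∈? h) (noPair z∈h))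

    A≡bigPart : A ≡ bigPart n f n
    A≡bigPart = Increasing-⊆⇒≡ Increasing-A incBig A⊆bigPart (Increasing-⊆⇒length≤ incBig Increasing-A bigPart⊆A)
      where incBig = Increasing-bigPart n f n (m≤m+n n _)

    B≡smallPart : B ≡ smallPart f n
    B≡smallPart = Increasing-⊆⇒≡ Increasing-B (Increasing-smallPart f n) B⊆smallPart (≤-reflexive (+-cancelˡ-≡ (length A) _ _ lengths))
      where
      lengths : length A + length (smallPart f n) ≡ length A + length B
      lengths = begin
        length A + length (smallPart f n)                 ≡⟨ cong (λ l → length l + length (smallPart f n)) A≡bigPart ⟩
        length (bigPart n f n) + length (smallPart f n)   ≡⟨ length-parts n f n ⟩
        n                                                 ≡⟨ sym length-A++B ⟩
        length (A ++ B)                                   ≡⟨ length-++ A ⟩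
        length A + length B                               ∎
        where open ≡-Reasoning

  runDecomposition⇒word : ∃[ bs ] (bs ∈ properVecs k × x ≡ word n bs)
  runDecomposition⇒word = bs , proper , trans x≡mirror (cong₂ (λ l l′ → mirror n (l ++ l′)) A≡bigPart B≡smallPart)
    where
    q∈h = ∈-++⁺ʳ A q∈B
    proper : bs ∈ properVecs k
    proper with q | q<m | q∈h | All.lookup InRange-A++B q∈h
    ... | suc j | s≤s j<k | q∈h′ | _ =
      ∈-properVecs⁺ bs j<k (trans (nthV-tabulate (λ j → does (bar n (suc j) ∈? h)) j<k) (dec-false (bar n (suc j) ∈? h) (noPair q∈h′)))
    ... | zero | _ | _ | (() , _)

-- Counting

Counted : ℕ → ℕ → List ℕ → Set
Counted n i x = InPopImage n x × head x ≡ just i × upperCovers n x ≡ n ∸ 1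

∈-words⇔ : ∀ n {k} → k < n → ∀ x → x ∈ map (word n) (properVecs k) ⇔ Counted n (bar n (suc k)) x
∈-words⇔ n {k} k<n x = mk⇔ to from
  where
  to : x ∈ map (word n) (properVecs k) → Counted n (bar n (suc k)) x
  to x∈ with bs , bs∈ , x≡ ← ∈-map⁻ (word n) x∈ =
    subst (Counted n _) (sym x≡) (word-inPopImage bs k<n bs∈ , head-word bs k<n , upperCovers-word bs k<n bs∈)
  from : Counted n (bar n (suc k)) x → x ∈ map (word n) (properVecs k)
  from ((bx , y , _ , pop-y) , head-x , covers-x) =
    let bs , bs∈ , x≡ = runDecomposition⇒word k<n (counted⇒runDecomposition {y = y} k<n bx pop-y head-x covers-x)
    in subst (_∈ map (word n) (properVecs k)) (sym x≡) (∈-map⁺ (word n) bs∈)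

mainTheorem9 : (n i : ℕ) → 1 ≤ n → suc n ≤ i → i ≤ 2 * n →
    Σ (List (List ℕ)) (λ L →
    Unique L ×
    (∀ x → x ∈ L ⇔ (InPopImage n x × head x ≡ just i × upperCovers n x ≡ n ∸ 1)) ×
    length L ≡ 2 ^ (2 * n ∸ i) ∸ 1)
mainTheorem9 n i 1≤n n<i i≤2n =
  map (word n) (properVecs k) ,
  Unique.map⁺ (word-injective n k<n) (Unique-properVecs k) ,
  (λ x → subst (λ j → x ∈ map (word n) (properVecs k) ⇔ Counted n j x) k̄≡i (∈-words⇔ n k<n x)) ,
  trans (length-map (word n) (properVecs k)) (length-properVecs k)
  where
  k = 2 * n ∸ i
  k<n : k < n
  k<n = ≤-<-trans (∸-monoʳ-≤ (2 * n) n<i) (reflect-upperHalf ≤-refl (subst (n <_) (sym (2*n≡n+n n)) (m<m+n n 1≤n)))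
  k̄≡i : bar n (suc k) ≡ i
  k̄≡i = m∸[m∸n]≡n i≤2n
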